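{- Let $p>2$ be a prime and let $[a_0,\dots,a_{t-1}]$ ($t\ge1$) be a nice finite Browkin continued fraction, and put $k_0=-v_p(a_0)$. Then there exist infinitely many $a_t\in\mathcal{Y}$ such that the periodic continued fraction $[a_0,\overline{a_1,\dots,a_{t-1},a_t,a_{t-1},\dots,a_1,2a_0}]$ (for $t=1$ this is $[a_0,\overline{a_1,2a_0}]$) converges in $\mathbb{Q}_p$ to a quadratic irrational of the form $\frac{1}{p^{k_0}\sqrt m}$ for some $m\in\mathbb{Z}$ (with $\sqrt m$ a square root of $m$ in $\mathbb{Q}_p$). Moreover, such $a_t$ can be chosen of the form $a_t=2c_t$ with $c_t\in\mathcal{Y}$.
   Context: Let $\mathcal{Y}=\mathbb{Z}[1/p]\cap(-p/2,p/2)$. A finite Browkin continued fraction $[a_0,\dots,a_{t-1}]$ is a sequence of elements of $\mathcal{Y}$ with $|a_i|_p>1$ for $1\le i\le t-1$. Its convergent sequences are $A_{ -1}=1$, $A_0=a_0$, $B_{ -1}=0$, $B_0=1$, $A_n=a_nA_{n-1}+A_{n-2}$, $B_n=a_nB_{n-1}+B_{n-2}$. For nonzero $x\in\mathbb{Z}[1/p]$, $\tilde x=x\,p^{ -v_p(x)}\in\mathbb{Z}$. The finite BCF is nice if: (a) $|a_0|_p>1$ and $|a_0|_\infty<\frac p4$; (b) $\left|\frac{A_{t-1}}{A_{t-2}}\right|_\infty>\frac4p$; (c) there exists an integer $q$ with $\tilde B_{t-1}\mid q\mid\tilde B_{t-1}^2$ whose class modulo $\tilde A_{t-1}^2$ belongs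 to the multiplicative subgroup generated by the class of $p$. For an infinite sequence $(a_n)$ in $\mathbb{Z}[1/p]$, the value of $[a_0,a_1,\dots]$ is the $p$-adic limit of $A_n/B_n$; the overline denotes the repeating block. -}

module Defs where

open import Data.Nat as ℕ using (ℕ; zero; suc; _<ᵇ_; _%_)
open import Data.Integer as ℤ using (ℤ; +_; -[1+_])
open import Data.Integer.Divisibility as ℤD using ()
open import Data.Rational as ℚ using (ℚ; _/_; 0ℚ; 1ℚ)
open import Data.Bool using (if_then_else_)
open import Data.Product using (Σ; ∃; _×_; _,_; proj₁; proj₂)
open import Data.Sum using (_⊎_)
open import Relation.Nullary using (¬_; yes; no)
open import Relation.Binary.PropositionalEquality using (_≡_; _≢_)

ι : ℤ → ℚ
ι z = z / 1

infixr 8 _^ℚ_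
_^ℚ_ : ℚ → ℕ → ℚ
x ^ℚ zero  = 1ℚ
x ^ℚ suc n = x ℚ.* (x ^ℚ n)

module _ (p : ℕ) where

  pℚ : ℚ
  pℚ = ι (+ p)

  -- x ∈ ℤ[1/p]  :  x · p^n is an integer for some n
  InZ1p : ℚ → Set
  InZ1p x = ∃ λ (n : ℕ) → ∃ λ (z : ℤ) → x ℚ.* (pℚ ^ℚ n) ≡ ι z

  -- x ∈ 𝒴 = ℤ[1/p] ∩ (-p/2, p/2)   (written as -p < 2x < p)
  InY : ℚ → Set
  InY x = InZ1p x × (ℚ.- pℚ ℚ.< ι (+ 2) ℚ.* x) × (ι (+ 2) ℚ.* x ℚ.< pℚ)

  -- |x|_p ≤ p^{-N}, i.e. x = p^N · u / w with u, w integers, p ∤ w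
  -- (for x = 0 this always holds)
  ValGe : ℕ → ℚ → Set
  ValGe N x = ∃ λ (u : ℤ) → ∃ λ (w : ℤ) →
              (¬ (+ p ℤD.∣ w)) × (x ℚ.* ι w ≡ ι u ℚ.* (pℚ ^ℚ N))

  PAbsGt1 : ℚ → Set
  PAbsGt1 x = ¬ ValGe 0 x

  PowEq : ℚ → ℚ → ℤ → Set
  PowEq x y (+ n)     = x ≡ y ℚ.* (pℚ ^ℚ n)
  PowEq x y -[1+ n ]  = x ℚ.* (pℚ ^ℚ suc n) ≡ y

  Vp : ℚ → ℤ → Set
  Vp x k = ∃ λ (u : ℤ) → (¬ (+ p ℤD.∣ u)) × PowEq x (ι u) k

  Tilde : ℚ → ℤ → Set
  Tilde x y = ∃ λ (k : ℤ) → Vp x k × PowEq x (ι y) k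

-- Convergents A_n, B_n of a sequence a : ℕ → ℚ
-- convPair a n = ((A_{n-1}, B_{n-1}), (A_n, B_n))

convPair : (ℕ → ℚ) → ℕ → (ℚ × ℚ) × (ℚ × ℚ)
convPair a zero = ((1ℚ , 0ℚ) , (a 0 , 1ℚ))
convPair a (suc n) with convPair a n
... | ((A' , B') , (A , B)) =
  ((A , B) , (a (suc n) ℚ.* A ℚ.+ A' , a (suc n) ℚ.* B ℚ.+ B'))

Aₙ : (ℕ → ℚ) → ℕ → ℚ
Aₙ a n = proj₁ (proj₂ (convPair a n))

Bₙ : (ℕ → ℚ) → ℕ → ℚ
Bₙ a n = proj₂ (proj₂ (convPair a n))

-- A_{n-1}, B_{n-1}  (so Aprev a 0 = A_{-1} = 1)
Aprev : (ℕ → ℚ) → ℕ → ℚ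
Aprev a n = proj₁ (proj₁ (convPair a n))

-- the n-th convergent A_n / B_n (given the value 0 when B_n = 0;
-- the convergence predicate below demands B_n ≠ 0 eventually)
convergent : (ℕ → ℚ) → ℕ → ℚ
convergent a n with Bₙ a n ℚ.≟ 0ℚ
... | yes _ = 0ℚ
... | no b≢0 = ℚ._÷_ (Aₙ a n) (Bₙ a n) {{ℚ.≢-nonZero b≢0}}

module _ (p : ℕ) where

  -- a : ℕ → ℚ, only the entries a 0, …, a (t-1) matter
  IsFiniteBCF : ℕ → (ℕ → ℚ) → Set
  IsFiniteBCF t a =
    (∀ i → i ℕ.< t → InY p (a i)) ×
    (∀ i → 1 ℕ.≤ i → i ℕ.< t → PAbsGt1 p (a i))

  IsNice : ℕ → (ℕ → ℚ) → Set
  IsNice t a =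
    (PAbsGt1 p (a 0) × (ℚ.- pℚ p ℚ.< ι (+ 4) ℚ.* a 0) × (ι (+ 4) ℚ.* a 0 ℚ.< pℚ p)) ×
    -- (b)  |A_{t-1} / A_{t-2}|_∞ > 4/p  (A_{t-2} ≠ 0, cross-multiplied)
    ((Aprev a (t ℕ.∸ 1) ≢ 0ℚ) ×
     (ι (+ 4) ℚ.* ℚ.∣ Aprev a (t ℕ.∸ 1) ∣ ℚ.< pℚ p ℚ.* ℚ.∣ Aₙ a (t ℕ.∸ 1) ∣)) ×
    (∃ λ (Ã : ℤ) → ∃ λ (B̃ : ℤ) →
       Tilde p (Aₙ a (t ℕ.∸ 1)) Ã × Tilde p (Bₙ a (t ℕ.∸ 1)) B̃ ×
       ∃ λ (q : ℤ) → (B̃ ℤD.∣ q) × (q ℤD.∣ (B̃ ℤ.* B̃)) ×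
         ∃ λ (j : ℕ) → (Ã ℤ.* Ã) ℤD.∣ (q ℤ.- (+ p) ℤ.^ j))

-- The periodic sequence [a_0, overline{a_1,…,a_{t-1},a_t,a_{t-1},…,a_1,2a_0}]
-- (period length 2t; for t = 1 it is [a_0, overline{a_1, 2a_0}])

periodBlock : ℕ → (ℕ → ℚ) → ℚ → ℕ → ℚ
periodBlock u a at j =
  if j <ᵇ u then a (suc j)
  else if j <ᵇ suc u then at
  else if j <ᵇ suc (u ℕ.+ u) then a (suc (u ℕ.+ u) ℕ.∸ j)
  else ι (+ 2) ℚ.* a 0

periodicSeq : ℕ → (ℕ → ℚ) → ℚ → ℕ → ℚ
periodicSeq zero    a at n       = a n   -- unused (t ≥ 1)
periodicSeq (suc u) a at zero    = a 0
periodicSeq (suc u) a at (suc n) = periodBlock u a at (n % (2 ℕ.* suc u))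

-- p-adic convergence of the convergents of s to a root of  p^{2k} m X² = 1,
-- i.e. to some 1/(p^k √m) in ℚ_p.  (ℚ_p is complete, so this is: the
-- convergents form a p-adic Cauchy sequence and p^{2k} m x_n² - 1 → 0.)

module _ (p : ℕ) where

  ConvergesToInvPowSqrt : (ℕ → ℚ) → ℕ → ℤ → Set
  ConvergesToInvPowSqrt s k m =
    (∃ λ n₀ → ∀ n → n₀ ℕ.≤ n → Bₙ s n ≢ 0ℚ) ×
    (∀ N → ∃ λ n₁ → ∀ n n' → n₁ ℕ.≤ n → n₁ ℕ.≤ n' →
        ValGe p N (convergent s n ℚ.- convergent s n')) ×
    (∀ N → ∃ λ n₁ → ∀ n → n₁ ℕ.≤ n →
        ValGe p N (ι ((+ p) ℤ.^ (2 ℕ.* k) ℤ.* m) ℚ.* (convergent s n ^ℚ 2) ℚ.- 1ℚ))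

  -- the limit is a quadratic irrational: m is not a square
  NonSquare : ℤ → Set
  NonSquare m = ¬ (∃ λ (r : ℤ) → r ℤ.* r ≡ m)

  Good : ℕ → (ℕ → ℚ) → ℕ → ℚ → Set
  Good t a k at = ∃ λ (m : ℤ) → NonSquare m ×
                   ConvergesToInvPowSqrt (periodicSeq t a at) k m

-- Write t = u + 1 and s = [a₀, a₁, …, a_u, x, a_u, …, a₁, 2a₀, …]. The convergent matrix at the end
-- of the first period is M(a₀) Q M(x) Qᵀ M(2a₀) with Q = M(a₁)⋯M(a_u), so a period acts on (A_n, B_n) through
-- [[α, β], [γ, α]] with α² − βγ = 1 and β, γ affine in x. If D β = γ for an integer D, then
-- D A_n² − B_n² is periodic, hence p-adically bounded, while |B_n|_p → ∞ because every partial
-- quotient has |·|_p > 1; so D (A_n / B_n)² → 1, i.e. A_n / B_n → 1 / √D with D = p^{2k₀} m.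
-- For x = 2c the condition D β = γ reads p^{2k₀} m A (cA + A') = B (cB + B'). Niceness (c) and the
-- order of p modulo Ã² allow c = −y₀ / p^J for every large J with m an integer; then
-- m Ã² = B̃² − r p^j is not a square, and niceness (b) keeps c and 2c in 𝒴.

module Submission where

open import Defs
open import Data.Nat as ℕ using (ℕ; _<_; _≤_; zero; suc; _<ᵇ_; _%_)
import Data.Nat.Properties as ℕP
import Data.Nat.Divisibility as ℕD
import Data.Nat.Solver
open import Data.Nat.Primality using (Prime; euclidsLemma; prime⇒irreducible)
open import Data.Nat.Coprimality as Cop using (Coprime; coprime-divisor)
open import Data.Nat.DivMod using (_/_; m<n⇒m%n≡m; [m+n]%n≡m%n; m≡m%n+[m/n]*n; m%n<n)
open import Data.Integer as ℤ using (ℤ; +_; -[1+_])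
import Data.Integer.Properties as ℤP
import Data.Integer.Divisibility as ℤD
import Data.Integer.Divisibility.Signed as ℤS
import Data.Integer.Solver
open import Data.Rational as ℚ using (ℚ; mkℚ; 0ℚ; 1ℚ)
import Data.Rational.Properties as ℚP
open import Data.Rational.Unnormalised using (mkℚᵘ; *≡*)
open import Data.Rational.Solver
open import Data.Fin using (Fin; toℕ; fromℕ<)
import Data.Fin.Properties as FinP
open import Data.List using (List; []; _∷_)
open import Data.List.Membership.Propositional using (_∉_)
open import Data.List.Relation.Unary.Any using (here; there)
open import Data.Bool using (true; false; if_then_else_; T)
open import Data.Unit using (tt)
open import Data.Empty using (⊥; ⊥-elim)
open import Data.Product using (Σ; ∃; _×_; _,_; proj₁; proj₂)
open import Data.Sum using (_⊎_; inj₁; inj₂)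
open import Relation.Nullary using (¬_; Dec; yes; no)
open import Relation.Binary.PropositionalEquality
  using (_≡_; _≢_; refl; sym; trans; cong; cong₂; subst; subst₂; module ≡-Reasoning)
open import Algebra.Properties.Group ℚP.+-0-group using () renaming (⁻¹-involutive to neg-involutive)

open +-*-Solver
module NS = Data.Nat.Solver.+-*-Solver
module ZS = Data.Integer.Solver.+-*-Solver

ι≡mkℚ : ∀ z → ι z ≡ mkℚ z 0 (Cop.sym (Cop.1-coprimeTo _))
ι≡mkℚ z = ℚP.↥p/↧p≡p (mkℚ z 0 (Cop.sym (Cop.1-coprimeTo _)))

ι-homo-+ : ∀ a b → ι (a ℤ.+ b) ≡ ι a ℚ.+ ι b
ι-homo-+ a b rewrite ι≡mkℚ a | ι≡mkℚ b =
  cong (ℚ._/ 1) (sym (cong₂ ℤ._+_ (ℤP.*-identityʳ a) (ℤP.*-identityʳ b)))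

ι-homo-* : ∀ a b → ι (a ℤ.* b) ≡ ι a ℚ.* ι b
ι-homo-* a b rewrite ι≡mkℚ a | ι≡mkℚ b = refl

ι-homo‿- : ∀ a → ι (ℤ.- a) ≡ ℚ.- ι a
ι-homo‿- (+ zero)   = refl
ι-homo‿- (+ suc n)  = refl
ι-homo‿- -[1+ n ]   = solve 1 (λ x → x := :- (:- x)) refl _

ι-homo-sub : ∀ a b → ι (a ℤ.- b) ≡ ι a ℚ.- ι b
ι-homo-sub a b = trans (ι-homo-+ a (ℤ.- b)) (cong (ι a ℚ.+_) (ι-homo‿- b))

ι-homo-*+* : ∀ a b c d → ι (a ℤ.* b ℤ.+ c ℤ.* d) ≡ ι a ℚ.* ι b ℚ.+ ι c ℚ.* ι d
ι-homo-*+* a b c d = trans (ι-homo-+ (a ℤ.* b) (c ℤ.* d)) (cong₂ ℚ._+_ (ι-homo-* a b) (ι-homo-* c d))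

ι-injective : ∀ {a b} → ι a ≡ ι b → a ≡ b
ι-injective {a} {b} e rewrite ι≡mkℚ a | ι≡mkℚ b = cong ℚ.↥_ e

ι≢0 : ∀ {z} → z ≢ + 0 → ι z ≢ 0ℚ
ι≢0 z≢0 e = z≢0 (ι-injective e)

ι-mono-< : ∀ {a b} → a ℤ.< b → ι a ℚ.< ι b
ι-mono-< {a} {b} lt rewrite ι≡mkℚ a | ι≡mkℚ b =
  ℚ.*<* (subst₂ ℤ._<_ (sym (ℤP.*-identityʳ a)) (sym (ℤP.*-identityʳ b)) lt)

ι-cancel-< : ∀ {a b} → ι a ℚ.< ι b → a ℤ.< b
ι-cancel-< {a} {b} lt rewrite ι≡mkℚ a | ι≡mkℚ b with lt
... | ℚ.*<* l = subst₂ ℤ._<_ (ℤP.*-identityʳ a) (ℤP.*-identityʳ b) l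

∣ι∣ : ∀ z → ℚ.∣ ι z ∣ ≡ ι (+ ℤ.∣ z ∣)
∣ι∣ z rewrite ι≡mkℚ z | ι≡mkℚ (+ ℤ.∣ z ∣) = refl

ι2≡1+1 : ι (+ 2) ≡ 1ℚ ℚ.+ 1ℚ
ι2≡1+1 = ι-homo-+ (+ 1) (+ 1)

ι-↧ : ∀ x → x ℚ.* ι (+ ℚ.↧ₙ x) ≡ ι (ℚ.↥ x)
ι-↧ (mkℚ n d c) rewrite ι≡mkℚ (+ suc d) | ι≡mkℚ n =
  trans (ℚP.fromℚᵘ-cong {mkℚᵘ (n ℤ.* + suc d) (d ℕ.* 1)} {mkℚᵘ n 0} (*≡* eq))
        (ℚP.↥p/↧p≡p (mkℚ n 0 (Cop.sym (Cop.1-coprimeTo _))))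
  where
  eq : n ℤ.* + suc d ℤ.* + 1 ≡ n ℤ.* + suc (d ℕ.* 1)
  eq = trans (ℤP.*-identityʳ _) (cong (λ z → n ℤ.* + suc z) (sym (ℕP.*-identityʳ d)))

*-cancelʳ-≢0 : ∀ {a b c : ℚ} → c ≢ 0ℚ → a ℚ.* c ≡ b ℚ.* c → a ≡ b
*-cancelʳ-≢0 {a} {b} {c} c≢0 e = begin
  a                  ≡⟨ solve 1 (λ a → a := a :* con 1ℚ) refl a ⟩
  a ℚ.* 1ℚ           ≡⟨ cong (a ℚ.*_) (sym (ℚP.*-inverseʳ c)) ⟩
  a ℚ.* (c ℚ.* c⁻¹)  ≡⟨ solve 3 (λ a c i → a :* (c :* i) := (a :* c) :* i) refl a c c⁻¹ ⟩
  (a ℚ.* c) ℚ.* c⁻¹  ≡⟨ cong (ℚ._* c⁻¹) e ⟩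
  (b ℚ.* c) ℚ.* c⁻¹  ≡⟨ solve 3 (λ a c i → (a :* c) :* i := a :* (c :* i)) refl b c c⁻¹ ⟩
  b ℚ.* (c ℚ.* c⁻¹)  ≡⟨ cong (b ℚ.*_) (ℚP.*-inverseʳ c) ⟩
  b ℚ.* 1ℚ           ≡⟨ solve 1 (λ a → a :* con 1ℚ := a) refl b ⟩
  b                  ∎
  where
  open ≡-Reasoning
  instance
    c-nonZero : ℚ.NonZero c
    c-nonZero = ℚ.≢-nonZero c≢0
  c⁻¹ : ℚ
  c⁻¹ = ℚ.1/ c

*-≢0 : ∀ {a b : ℚ} → a ≢ 0ℚ → b ≢ 0ℚ → a ℚ.* b ≢ 0ℚ
*-≢0 {a} {b} a≢0 b≢0 e =
  b≢0 (*-cancelʳ-≢0 a≢0 (trans (ℚP.*-comm b a) (trans e (sym (ℚP.*-zeroˡ a)))))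

Bprev : (ℕ → ℚ) → ℕ → ℚ
Bprev a n = proj₂ (proj₁ (convPair a n))

convDet : (ℕ → ℚ) → ℕ → ℚ
convDet s n = Aₙ s n ℚ.* Bprev s n ℚ.- Aprev s n ℚ.* Bₙ s n

convDet-zero : ∀ s → convDet s 0 ≡ ℚ.- 1ℚ
convDet-zero s = solve 1 (λ a → a :* con 0ℚ :- con 1ℚ :* con 1ℚ := :- con 1ℚ) refl (s 0)

convDet-suc : ∀ s n → convDet s (suc n) ≡ ℚ.- convDet s n
convDet-suc s n =
  solve 5 (λ c A Ap B Bp → (c :* A :+ Ap) :* B :- A :* (c :* B :+ Bp) := :- (A :* Bp :- Ap :* B))
    refl (s (suc n)) (Aₙ s n) (Aprev s n) (Bₙ s n) (Bprev s n)

convDet-even : ∀ s k → convDet s (k ℕ.+ k) ≡ ℚ.- 1ℚ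
convDet-even s zero = convDet-zero s
convDet-even s (suc k) rewrite ℕP.+-suc k k = begin
  convDet s (suc (suc (k ℕ.+ k)))  ≡⟨ convDet-suc s (suc (k ℕ.+ k)) ⟩
  ℚ.- convDet s (suc (k ℕ.+ k))    ≡⟨ cong ℚ.-_ (convDet-suc s (k ℕ.+ k)) ⟩
  ℚ.- (ℚ.- convDet s (k ℕ.+ k))    ≡⟨ neg-involutive (convDet s (k ℕ.+ k)) ⟩
  convDet s (k ℕ.+ k)              ≡⟨ convDet-even s k ⟩
  ℚ.- 1ℚ                           ∎
  where open ≡-Reasoning

convDet-±1 : ∀ s n → convDet s n ≡ 1ℚ ⊎ convDet s n ≡ ℚ.- 1ℚ
convDet-±1 s zero = inj₂ (convDet-zero s)
convDet-±1 s (suc n) with convDet-±1 s n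
... | inj₁ e = inj₂ (trans (convDet-suc s n) (cong ℚ.-_ e))
... | inj₂ e = inj₁ (trans (convDet-suc s n) (trans (cong ℚ.-_ e) (neg-involutive 1ℚ)))

convergents-agree : ∀ f g n → (∀ i → i ≤ n → f i ≡ g i) →
  (Aₙ f n ≡ Aₙ g n) × (Aprev f n ≡ Aprev g n) × (Bₙ f n ≡ Bₙ g n) × (Bprev f n ≡ Bprev g n)
convergents-agree f g zero h = h 0 ℕ.z≤n , refl , refl , refl
convergents-agree f g (suc n) h with convergents-agree f g n (λ i le → h i (ℕP.m≤n⇒m≤1+n le))
... | eA , eA' , eB , eB' =
  cong₂ (λ c (xy : ℚ × ℚ) → c ℚ.* proj₁ xy ℚ.+ proj₂ xy) fn (cong₂ _,_ eA eA') , eA ,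
  cong₂ (λ c (xy : ℚ × ℚ) → c ℚ.* proj₁ xy ℚ.+ proj₂ xy) fn (cong₂ _,_ eB eB') , eB
  where
  fn : f (suc n) ≡ g (suc n)
  fn = h (suc n) ℕP.≤-refl

record Mat₂ : Set where
  constructor mat
  field
    m₁₁ m₁₂ m₂₁ m₂₂ : ℚ
open Mat₂

infixl 7 _∙_
_∙_ : Mat₂ → Mat₂ → Mat₂
mat a b c d ∙ mat e f g h =
  mat (a ℚ.* e ℚ.+ b ℚ.* g) (a ℚ.* f ℚ.+ b ℚ.* h) (c ℚ.* e ℚ.+ d ℚ.* g) (c ℚ.* f ℚ.+ d ℚ.* h)

infix 8 _ᵀ
_ᵀ : Mat₂ → Mat₂
mat a b c d ᵀ = mat a c b d

I₂ : Mat₂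
I₂ = mat 1ℚ 0ℚ 0ℚ 1ℚ

cfMat : ℚ → Mat₂
cfMat c = mat c 1ℚ 1ℚ 0ℚ

mat-cong : ∀ {a b c d a' b' c' d'} → a ≡ a' → b ≡ b' → c ≡ c' → d ≡ d' →
           mat a b c d ≡ mat a' b' c' d'
mat-cong refl refl refl refl = refl

∙-assoc : ∀ X Y Z → (X ∙ Y) ∙ Z ≡ X ∙ (Y ∙ Z)
∙-assoc (mat a b c d) (mat e f g h) (mat i j k l) =
  mat-cong (entry a b i k) (entry a b j l) (entry c d i k) (entry c d j l)
  where
  entry : ∀ a b i k → (a ℚ.* e ℚ.+ b ℚ.* g) ℚ.* i ℚ.+ (a ℚ.* f ℚ.+ b ℚ.* h) ℚ.* k
                    ≡ a ℚ.* (e ℚ.* i ℚ.+ f ℚ.* k) ℚ.+ b ℚ.* (g ℚ.* i ℚ.+ h ℚ.* k)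
  entry a b i k = solve 8 (λ a b e f g h i k → (a :* e :+ b :* g) :* i :+ (a :* f :+ b :* h) :* k
                             := a :* (e :* i :+ f :* k) :+ b :* (g :* i :+ h :* k)) refl a b e f g h i k

∙-identityʳ : ∀ X → X ∙ I₂ ≡ X
∙-identityʳ (mat a b c d) = mat-cong (pick₁ a b) (pick₂ a b) (pick₁ c d) (pick₂ c d)
  where
  pick₁ : ∀ a b → a ℚ.* 1ℚ ℚ.+ b ℚ.* 0ℚ ≡ a
  pick₁ = solve 2 (λ a b → a :* con 1ℚ :+ b :* con 0ℚ := a) refl
  pick₂ : ∀ a b → a ℚ.* 0ℚ ℚ.+ b ℚ.* 1ℚ ≡ b
  pick₂ = solve 2 (λ a b → a :* con 0ℚ :+ b :* con 1ℚ := b) refl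

∙-identityˡ : ∀ X → I₂ ∙ X ≡ X
∙-identityˡ (mat a b c d) = mat-cong (pick₁ a c) (pick₁ b d) (pick₂ a c) (pick₂ b d)
  where
  pick₁ : ∀ a c → 1ℚ ℚ.* a ℚ.+ 0ℚ ℚ.* c ≡ a
  pick₁ = solve 2 (λ a c → con 1ℚ :* a :+ con 0ℚ :* c := a) refl
  pick₂ : ∀ a c → 0ℚ ℚ.* a ℚ.+ 1ℚ ℚ.* c ≡ c
  pick₂ = solve 2 (λ a c → con 0ℚ :* a :+ con 1ℚ :* c := c) refl

ᵀ-∙ : ∀ X Y → (X ∙ Y) ᵀ ≡ Y ᵀ ∙ X ᵀ
ᵀ-∙ (mat a b c d) (mat e f g h) = mat-cong (entry a b e g) (entry c d e g) (entry a b f h) (entry c d f h)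
  where
  entry : ∀ a b e g → a ℚ.* e ℚ.+ b ℚ.* g ≡ e ℚ.* a ℚ.+ g ℚ.* b
  entry = solve 4 (λ a b e g → a :* e :+ b :* g := e :* a :+ g :* b) refl

∏cf : (ℕ → ℚ) → ℕ → ℕ → Mat₂
∏cf f i zero    = I₂
∏cf f i (suc n) = cfMat (f i) ∙ ∏cf f (suc i) n

∏cf-rev : (ℕ → ℚ) → ℕ → ℕ → Mat₂
∏cf-rev f i zero    = I₂
∏cf-rev f i (suc n) = ∏cf-rev f (suc i) n ∙ cfMat (f i)

∏cf-ᵀ : ∀ f i n → ∏cf f i n ᵀ ≡ ∏cf-rev f i n
∏cf-ᵀ f i zero    = refl
∏cf-ᵀ f i (suc n) = trans (ᵀ-∙ (cfMat (f i)) (∏cf f (suc i) n)) (cong (_∙ cfMat (f i)) (∏cf-ᵀ f (suc i) n))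

∏cf-+ : ∀ f i n m → ∏cf f i (n ℕ.+ m) ≡ ∏cf f i n ∙ ∏cf f (i ℕ.+ n) m
∏cf-+ f i zero m = trans (cong (λ j → ∏cf f j m) (sym (ℕP.+-identityʳ i))) (sym (∙-identityˡ _))
∏cf-+ f i (suc n) m = begin
  cfMat (f i) ∙ ∏cf f (suc i) (n ℕ.+ m)                        ≡⟨ cong (cfMat (f i) ∙_) (∏cf-+ f (suc i) n m) ⟩
  cfMat (f i) ∙ (∏cf f (suc i) n ∙ ∏cf f (suc i ℕ.+ n) m)      ≡⟨ cong (λ j → cfMat (f i) ∙ (∏cf f (suc i) n ∙ ∏cf f j m)) (sym (ℕP.+-suc i n)) ⟩
  cfMat (f i) ∙ (∏cf f (suc i) n ∙ ∏cf f (i ℕ.+ suc n) m)      ≡⟨ sym (∙-assoc (cfMat (f i)) (∏cf f (suc i) n) _) ⟩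
  cfMat (f i) ∙ ∏cf f (suc i) n ∙ ∏cf f (i ℕ.+ suc n) m        ∎
  where open ≡-Reasoning

∏cf-snoc : ∀ f i n → ∏cf f i (suc n) ≡ ∏cf f i n ∙ cfMat (f (i ℕ.+ n))
∏cf-snoc f i n =
  trans (cong (∏cf f i) (ℕP.+-comm 1 n)) (trans (∏cf-+ f i n 1) (cong (∏cf f i n ∙_) (∙-identityʳ _)))

∏cf-cong : ∀ f g i j n → (∀ k → k < n → f (i ℕ.+ k) ≡ g (j ℕ.+ k)) → ∏cf f i n ≡ ∏cf g j n
∏cf-cong f g i j zero    h = refl
∏cf-cong f g i j (suc n) h = cong₂ _∙_ (cong cfMat head) (∏cf-cong f g (suc i) (suc j) n tail)
  where
  head : f i ≡ g j
  head = trans (cong f (sym (ℕP.+-identityʳ i))) (trans (h 0 (ℕ.s≤s ℕ.z≤n)) (cong g (ℕP.+-identityʳ j)))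
  tail : ∀ k → k < n → f (suc i ℕ.+ k) ≡ g (suc j ℕ.+ k)
  tail k k<n = trans (cong f (sym (ℕP.+-suc i k))) (trans (h (suc k) (ℕ.s≤s k<n)) (cong g (ℕP.+-suc j k)))

∏cf≡∏cf-rev : ∀ f g i j n → (∀ k → k < n → f (i ℕ.+ k) ≡ g (j ℕ.+ (n ℕ.∸ suc k))) →
              ∏cf f i n ≡ ∏cf-rev g j n
∏cf≡∏cf-rev f g i j zero    h = refl
∏cf≡∏cf-rev f g i j (suc n) h =
  trans (∏cf-snoc f i n) (cong₂ _∙_ (∏cf≡∏cf-rev f g i (suc j) n init) (cong cfMat last))
  where
  init : ∀ k → k < n → f (i ℕ.+ k) ≡ g (suc j ℕ.+ (n ℕ.∸ suc k))
  init k k<n = trans (h k (ℕP.m<n⇒m<1+n k<n))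
    (cong g (trans (cong (j ℕ.+_) (ℕP.+-∸-assoc 1 k<n)) (ℕP.+-suc j (n ℕ.∸ suc k))))
  last : f (i ℕ.+ n) ≡ g j
  last = trans (h n ℕP.≤-refl) (cong g (trans (cong (j ℕ.+_) (ℕP.n∸n≡0 n)) (ℕP.+-identityʳ j)))

convMat : (ℕ → ℚ) → ℕ → Mat₂
convMat s n = mat (Aₙ s n) (Aprev s n) (Bₙ s n) (Bprev s n)

convMat-suc : ∀ s n → convMat s (suc n) ≡ convMat s n ∙ cfMat (s (suc n))
convMat-suc s n = mat-cong (new (Aₙ s n) (Aprev s n)) (old (Aₙ s n) (Aprev s n))
                           (new (Bₙ s n) (Bprev s n)) (old (Bₙ s n) (Bprev s n))
  where
  new : ∀ X X' → s (suc n) ℚ.* X ℚ.+ X' ≡ X ℚ.* s (suc n) ℚ.+ X' ℚ.* 1ℚ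
  new = solve 3 (λ c X X' → c :* X :+ X' := X :* c :+ X' :* con 1ℚ) refl (s (suc n))
  old : ∀ X X' → X ≡ X ℚ.* 1ℚ ℚ.+ X' ℚ.* 0ℚ
  old = solve 2 (λ X X' → X := X :* con 1ℚ :+ X' :* con 0ℚ) refl

convMat≡∏cf : ∀ s n → convMat s n ≡ ∏cf s 0 (suc n)
convMat≡∏cf s zero    = sym (∙-identityʳ (cfMat (s 0)))
convMat≡∏cf s (suc n) = trans (convMat-suc s n)
  (trans (cong (_∙ cfMat (s (suc n))) (convMat≡∏cf s n)) (sym (∏cf-snoc s 0 (suc n))))

if-<ᵇ-true : ∀ {A : Set} {m n} {y z : A} → m < n → (if m <ᵇ n then y else z) ≡ y
if-<ᵇ-true {m = m} {n} m<n with m <ᵇ n | ℕP.<⇒<ᵇ m<n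
... | true | _ = refl

if-<ᵇ-false : ∀ {A : Set} {m n} {y z : A} → n ≤ m → (if m <ᵇ n then y else z) ≡ z
if-<ᵇ-false {m = m} {n} n≤m with m <ᵇ n in eq
... | true  = ⊥-elim (ℕP.<⇒≱ (ℕP.<ᵇ⇒< m n (subst T (sym eq) tt)) n≤m)
... | false = refl

periodBlock-cases : ∀ (a : ℕ → ℚ) x u j →
  (Σ ℕ λ i → 1 ≤ i × i ≤ u × periodBlock u a x j ≡ a i) ⊎
  (periodBlock u a x j ≡ x) ⊎ (periodBlock u a x j ≡ ι (+ 2) ℚ.* a 0)
periodBlock-cases a x u j with j <ᵇ u in e₁
... | true = inj₁ (suc j , ℕ.s≤s ℕ.z≤n , ℕP.<ᵇ⇒< j u (subst T (sym e₁) tt) , refl)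
... | false with j <ᵇ suc u in e₂
...   | true = inj₂ (inj₁ refl)
...   | false with j <ᵇ suc (u ℕ.+ u) in e₃
...     | false = inj₂ (inj₂ refl)
...     | true  = inj₁ (suc (u ℕ.+ u) ℕ.∸ j , ℕP.m<n⇒0<n∸m j<2u+1 , mirror≤u , refl)
  where
  j<2u+1 : j < suc (u ℕ.+ u)
  j<2u+1 = ℕP.<ᵇ⇒< j _ (subst T (sym e₃) tt)
  u<j : suc u ≤ j
  u<j = ℕP.≮⇒≥ (λ lt → subst T e₂ (ℕP.<⇒<ᵇ lt))
  mirror≤u : suc (u ℕ.+ u) ℕ.∸ j ≤ u
  mirror≤u = ℕP.≤-trans (ℕP.∸-monoʳ-≤ (suc (u ℕ.+ u)) u<j) (ℕP.≤-reflexive (ℕP.m+n∸m≡n u u))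

-- Symbolic copies of the matrix operations: the ring solver can then normalise
-- the entries of a whole product of matrices at once.
record PolyMat₂ (n : ℕ) : Set where
  constructor pmat
  field
    p₁₁ p₁₂ p₂₁ p₂₂ : Polynomial n
open PolyMat₂

infixl 7 _∙ₚ_
_∙ₚ_ : ∀ {n} → PolyMat₂ n → PolyMat₂ n → PolyMat₂ n
pmat a b c d ∙ₚ pmat e f g h = pmat (a :* e :+ b :* g) (a :* f :+ b :* h) (c :* e :+ d :* g) (c :* f :+ d :* h)

module Periodic (a : ℕ → ℚ) (x : ℚ) (u : ℕ) where

  s : ℕ → ℚ
  s = periodicSeq (suc u) a x

  N : ℕ
  N = 2 ℕ.* suc u

  private
    block : ℕ → ℚ
    block = periodBlock u a x

    u<N : u < N
    u<N = ℕP.≤-trans (ℕP.n<1+n u) (ℕP.m≤m+n (suc u) _)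

  s-periodic : ∀ n → s (suc (n ℕ.+ N)) ≡ s (suc n)
  s-periodic n = cong block ([m+n]%n≡m%n n N)

  s-head : ∀ k → k < u → s (suc k) ≡ a (suc k)
  s-head k k<u = trans (cong block (m<n⇒m%n≡m (ℕP.<-trans k<u u<N))) (if-<ᵇ-true k<u)

  s-middle : s (suc u) ≡ x
  s-middle = trans (cong block (m<n⇒m%n≡m u<N))
                   (trans (if-<ᵇ-false {m = u} {u} ℕP.≤-refl) (if-<ᵇ-true (ℕP.n<1+n u)))

  s-mirror : ∀ k → k < u → s (suc (suc u ℕ.+ k)) ≡ a (u ℕ.∸ k)
  s-mirror k k<u = begin
    block ((suc u ℕ.+ k) % N) ≡⟨ cong block (m<n⇒m%n≡m (ℕ.s≤s (ℕP.+-monoʳ-< u k<u+1))) ⟩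
    block (suc u ℕ.+ k)       ≡⟨ if-<ᵇ-false (ℕP.≤-trans (ℕP.n≤1+n u) (ℕP.m≤m+n (suc u) k)) ⟩
    _                        ≡⟨ if-<ᵇ-false (ℕP.m≤m+n (suc u) k) ⟩
    _                        ≡⟨ if-<ᵇ-true (ℕ.s≤s (ℕP.+-monoʳ-< u k<u)) ⟩
    a (suc (u ℕ.+ u) ℕ.∸ suc (u ℕ.+ k)) ≡⟨ cong a (ℕP.[m+n]∸[m+o]≡n∸o u u k) ⟩
    a (u ℕ.∸ k)              ∎
    where
    open ≡-Reasoning
    k<u+1 : k < suc (u ℕ.+ 0)
    k<u+1 = ℕP.<-trans k<u (ℕ.s≤s (ℕP.≤-reflexive (sym (ℕP.+-identityʳ u))))

  s-end : s (suc (suc (u ℕ.+ u))) ≡ ι (+ 2) ℚ.* a 0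
  s-end = trans (cong block (m<n⇒m%n≡m 2u+1<N))
    (trans (if-<ᵇ-false (ℕP.≤-trans (ℕP.m≤m+n u u) (ℕP.n≤1+n _)))
    (trans (if-<ᵇ-false (ℕ.s≤s (ℕP.m≤m+n u u))) (if-<ᵇ-false {m = suc (u ℕ.+ u)} {suc (u ℕ.+ u)} ℕP.≤-refl)))
    where
    2u+1<N : suc (u ℕ.+ u) < N
    2u+1<N = ℕP.≤-reflexive (NS.solve 1 (λ u → NS.con 2 NS.:+ (u NS.:+ u) NS.:= NS.con 2 NS.:* (NS.con 1 NS.:+ u)) refl u)

  Q : Mat₂
  Q = ∏cf a 1 u

  convMat-a : convMat a u ≡ cfMat (a 0) ∙ Q
  convMat-a = convMat≡∏cf a u

  convMat-period : convMat s N ≡ cfMat (a 0) ∙ (Q ∙ (cfMat x ∙ (Q ᵀ ∙ (cfMat ((1ℚ ℚ.+ 1ℚ) ℚ.* a 0) ∙ I₂))))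
  convMat-period = begin
    convMat s N
      ≡⟨ convMat≡∏cf s N ⟩
    cfMat (a 0) ∙ ∏cf s 1 N
      ≡⟨ cong (λ n → cfMat (a 0) ∙ ∏cf s 1 n) N≡ ⟩
    cfMat (a 0) ∙ ∏cf s 1 (u ℕ.+ (1 ℕ.+ (u ℕ.+ (1 ℕ.+ 0))))
      ≡⟨ cong (cfMat (a 0) ∙_) (∏cf-+ s 1 u (1 ℕ.+ (u ℕ.+ (1 ℕ.+ 0)))) ⟩
    cfMat (a 0) ∙ (∏cf s 1 u ∙ (cfMat (s (suc u)) ∙ ∏cf s (2 ℕ.+ u) (u ℕ.+ 1)))
      ≡⟨ cong (λ z → cfMat (a 0) ∙ (∏cf s 1 u ∙ (cfMat (s (suc u)) ∙ z))) (∏cf-+ s (2 ℕ.+ u) u 1) ⟩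
    cfMat (a 0) ∙ (∏cf s 1 u ∙ (cfMat (s (suc u)) ∙ (∏cf s (2 ℕ.+ u) u ∙ (cfMat (s (2 ℕ.+ u ℕ.+ u)) ∙ I₂))))
      ≡⟨ cong₂ (λ z w → cfMat (a 0) ∙ (z ∙ w)) head-block
           (cong₂ (λ z w → cfMat z ∙ w) s-middle (cong₂ (λ z w → z ∙ (cfMat w ∙ I₂)) mirror-block end)) ⟩
    cfMat (a 0) ∙ (Q ∙ (cfMat x ∙ (Q ᵀ ∙ (cfMat ((1ℚ ℚ.+ 1ℚ) ℚ.* a 0) ∙ I₂)))) ∎
    where
    open ≡-Reasoning
    N≡ : N ≡ u ℕ.+ (1 ℕ.+ (u ℕ.+ (1 ℕ.+ 0)))
    N≡ = NS.solve 1 (λ u → NS.con 2 NS.:* (NS.con 1 NS.:+ u) NS.:= u NS.:+ (NS.con 1 NS.:+ (u NS.:+ (NS.con 1 NS.:+ NS.con 0)))) refl u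
    head-block : ∏cf s 1 u ≡ Q
    head-block = ∏cf-cong s a 1 1 u s-head
    mirror-block : ∏cf s (2 ℕ.+ u) u ≡ Q ᵀ
    mirror-block = trans (∏cf≡∏cf-rev s a (2 ℕ.+ u) 1 u (λ k k<u → trans (s-mirror k k<u) (cong a (ℕP.+-∸-assoc 1 k<u))))
                         (sym (∏cf-ᵀ a 1 u))
    end : s (2 ℕ.+ u ℕ.+ u) ≡ (1ℚ ℚ.+ 1ℚ) ℚ.* a 0
    end = trans s-end (cong (ℚ._* a 0) ι2≡1+1)

  α β γ : ℚ
  α = Aprev s N
  β = Aₙ s N ℚ.- a 0 ℚ.* Aprev s N
  γ = Bprev s N

  private
    cfMatₚ : ∀ {n} → Polynomial n → PolyMat₂ n
    cfMatₚ c = pmat c (con 1ℚ) (con 1ℚ) (con 0ℚ)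

    a₀Qₚ periodₚ : ∀ {n} → (a₀ x q₁₁ q₁₂ q₂₁ q₂₂ : Polynomial n) → PolyMat₂ n
    a₀Qₚ a₀ x q₁₁ q₁₂ q₂₁ q₂₂ = cfMatₚ a₀ ∙ₚ pmat q₁₁ q₁₂ q₂₁ q₂₂
    periodₚ a₀ x q₁₁ q₁₂ q₂₁ q₂₂ =
      cfMatₚ a₀ ∙ₚ (pmat q₁₁ q₁₂ q₂₁ q₂₂ ∙ₚ (cfMatₚ x ∙ₚ (pmat q₁₁ q₂₁ q₁₂ q₂₂ ∙ₚ
        (cfMatₚ ((con 1ℚ :+ con 1ℚ) :* a₀) ∙ₚ pmat (con 1ℚ) (con 0ℚ) (con 0ℚ) (con 1ℚ)))))

    entry : (Mat₂ → ℚ) → ℚ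
    entry m = m (cfMat (a 0) ∙ (Q ∙ (cfMat x ∙ (Q ᵀ ∙ (cfMat ((1ℚ ℚ.+ 1ℚ) ℚ.* a 0) ∙ I₂)))))

    entry-a : (Mat₂ → ℚ) → ℚ
    entry-a m = m (cfMat (a 0) ∙ Q)

  B-period : Bₙ s N ≡ γ ℚ.* a 0 ℚ.+ α
  B-period = begin
    Bₙ s N                          ≡⟨ cong m₂₁ convMat-period ⟩
    entry m₂₁                       ≡⟨ solve 6 (λ a₀ x q₁₁ q₁₂ q₂₁ q₂₂ →
                                         p₂₁ (periodₚ a₀ x q₁₁ q₁₂ q₂₁ q₂₂)
                                      := p₂₂ (periodₚ a₀ x q₁₁ q₁₂ q₂₁ q₂₂) :* a₀ :+ p₁₂ (periodₚ a₀ x q₁₁ q₁₂ q₂₁ q₂₂))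
                                         refl (a 0) x (m₁₁ Q) (m₁₂ Q) (m₂₁ Q) (m₂₂ Q) ⟩
    entry m₂₂ ℚ.* a 0 ℚ.+ entry m₁₂ ≡⟨ sym (cong₂ (λ z w → z ℚ.* a 0 ℚ.+ w) (cong m₂₂ convMat-period) (cong m₁₂ convMat-period)) ⟩
    γ ℚ.* a 0 ℚ.+ α                 ∎
    where open ≡-Reasoning

  β≡ : β ≡ x ℚ.* Aₙ a u ℚ.* Aₙ a u ℚ.+ (1ℚ ℚ.+ 1ℚ) ℚ.* Aₙ a u ℚ.* Aprev a u
  β≡ = begin
    β                                      ≡⟨ cong₂ (λ z w → z ℚ.- a 0 ℚ.* w) (cong m₁₁ convMat-period) (cong m₁₂ convMat-period) ⟩
    entry m₁₁ ℚ.- a 0 ℚ.* entry m₁₂        ≡⟨ solve 6 (λ a₀ x q₁₁ q₁₂ q₂₁ q₂₂ →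
                                                p₁₁ (periodₚ a₀ x q₁₁ q₁₂ q₂₁ q₂₂) :- a₀ :* p₁₂ (periodₚ a₀ x q₁₁ q₁₂ q₂₁ q₂₂)
                                             := x :* p₁₁ (a₀Qₚ a₀ x q₁₁ q₁₂ q₂₁ q₂₂) :* p₁₁ (a₀Qₚ a₀ x q₁₁ q₁₂ q₂₁ q₂₂)
                                                :+ (con 1ℚ :+ con 1ℚ) :* p₁₁ (a₀Qₚ a₀ x q₁₁ q₁₂ q₂₁ q₂₂) :* p₁₂ (a₀Qₚ a₀ x q₁₁ q₁₂ q₂₁ q₂₂))
                                                refl (a 0) x (m₁₁ Q) (m₁₂ Q) (m₂₁ Q) (m₂₂ Q) ⟩
    x ℚ.* entry-a m₁₁ ℚ.* entry-a m₁₁ ℚ.+ (1ℚ ℚ.+ 1ℚ) ℚ.* entry-a m₁₁ ℚ.* entry-a m₁₂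
                                           ≡⟨ sym (cong₂ (λ z w → x ℚ.* z ℚ.* z ℚ.+ (1ℚ ℚ.+ 1ℚ) ℚ.* z ℚ.* w) (cong m₁₁ convMat-a) (cong m₁₂ convMat-a)) ⟩
    x ℚ.* Aₙ a u ℚ.* Aₙ a u ℚ.+ (1ℚ ℚ.+ 1ℚ) ℚ.* Aₙ a u ℚ.* Aprev a u ∎
    where open ≡-Reasoning

  γ≡ : γ ≡ x ℚ.* Bₙ a u ℚ.* Bₙ a u ℚ.+ (1ℚ ℚ.+ 1ℚ) ℚ.* Bₙ a u ℚ.* Bprev a u
  γ≡ = begin
    γ                                      ≡⟨ cong m₂₂ convMat-period ⟩
    entry m₂₂                              ≡⟨ solve 6 (λ a₀ x q₁₁ q₁₂ q₂₁ q₂₂ →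
                                                p₂₂ (periodₚ a₀ x q₁₁ q₁₂ q₂₁ q₂₂)
                                             := x :* p₂₁ (a₀Qₚ a₀ x q₁₁ q₁₂ q₂₁ q₂₂) :* p₂₁ (a₀Qₚ a₀ x q₁₁ q₁₂ q₂₁ q₂₂)
                                                :+ (con 1ℚ :+ con 1ℚ) :* p₂₁ (a₀Qₚ a₀ x q₁₁ q₁₂ q₂₁ q₂₂) :* p₂₂ (a₀Qₚ a₀ x q₁₁ q₁₂ q₂₁ q₂₂))
                                                refl (a 0) x (m₁₁ Q) (m₁₂ Q) (m₂₁ Q) (m₂₂ Q) ⟩
    x ℚ.* entry-a m₂₁ ℚ.* entry-a m₂₁ ℚ.+ (1ℚ ℚ.+ 1ℚ) ℚ.* entry-a m₂₁ ℚ.* entry-a m₂₂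
                                           ≡⟨ sym (cong₂ (λ z w → x ℚ.* z ℚ.* z ℚ.+ (1ℚ ℚ.+ 1ℚ) ℚ.* z ℚ.* w) (cong m₂₁ convMat-a) (cong m₂₂ convMat-a)) ⟩
    x ℚ.* Bₙ a u ℚ.* Bₙ a u ℚ.+ (1ℚ ℚ.+ 1ℚ) ℚ.* Bₙ a u ℚ.* Bprev a u ∎
    where open ≡-Reasoning

  α²-βγ≡1 : α ℚ.* α ℚ.- β ℚ.* γ ≡ 1ℚ
  α²-βγ≡1 = begin
    α ℚ.* α ℚ.- β ℚ.* γ                        ≡⟨ solve 4 (λ A α γ a₀ → α :* α :- (A :- a₀ :* α) :* γ := :- (A :* γ :- α :* (γ :* a₀ :+ α)))
                                                     refl (Aₙ s N) α γ (a 0) ⟩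
    ℚ.- (Aₙ s N ℚ.* γ ℚ.- α ℚ.* (γ ℚ.* a 0 ℚ.+ α)) ≡⟨ cong (λ z → ℚ.- (Aₙ s N ℚ.* γ ℚ.- α ℚ.* z)) (sym B-period) ⟩
    ℚ.- convDet s N                            ≡⟨ cong ℚ.-_ (subst (λ n → convDet s n ≡ ℚ.- 1ℚ) N≡u+1+u+1 (convDet-even s (suc u))) ⟩
    ℚ.- (ℚ.- 1ℚ)                               ≡⟨ neg-involutive 1ℚ ⟩
    1ℚ                                         ∎
    where
    open ≡-Reasoning
    N≡u+1+u+1 : suc u ℕ.+ suc u ≡ N
    N≡u+1+u+1 = cong (suc u ℕ.+_) (sym (ℕP.+-identityʳ (suc u)))

  PeriodShift : ℕ → Set
  PeriodShift n = (Aₙ s (n ℕ.+ N)    ≡ α ℚ.* Aₙ s n ℚ.+ β ℚ.* Bₙ s n) ×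
                  (Aprev s (n ℕ.+ N) ≡ α ℚ.* Aprev s n ℚ.+ β ℚ.* Bprev s n) ×
                  (Bₙ s (n ℕ.+ N)    ≡ γ ℚ.* Aₙ s n ℚ.+ α ℚ.* Bₙ s n) ×
                  (Bprev s (n ℕ.+ N) ≡ γ ℚ.* Aprev s n ℚ.+ α ℚ.* Bprev s n)

  period-shift : ∀ n → PeriodShift n
  period-shift zero =
    solve 3 (λ A α a₀ → A := α :* a₀ :+ (A :- a₀ :* α) :* con 1ℚ) refl (Aₙ s N) α (a 0) ,
    solve 2 (λ α β → α := α :* con 1ℚ :+ β :* con 0ℚ) refl α β ,
    trans B-period (solve 3 (λ γ a₀ α → γ :* a₀ :+ α := γ :* a₀ :+ α :* con 1ℚ) refl γ (a 0) α) ,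
    solve 2 (λ γ α → γ := γ :* con 1ℚ :+ α :* con 0ℚ) refl γ α
  period-shift (suc n) with period-shift n
  ... | eA , eA' , eB , eB' = step α β eA eA' , eA , step γ α eB eB' , eB
    where
    c : ℚ
    c = s (suc n)
    step : ∀ μ ν {X Y} → X ≡ μ ℚ.* Aₙ s n ℚ.+ ν ℚ.* Bₙ s n → Y ≡ μ ℚ.* Aprev s n ℚ.+ ν ℚ.* Bprev s n →
           s (suc (n ℕ.+ N)) ℚ.* X ℚ.+ Y ≡ μ ℚ.* Aₙ s (suc n) ℚ.+ ν ℚ.* Bₙ s (suc n)
    step μ ν {X} {Y} eX eY = begin
      s (suc (n ℕ.+ N)) ℚ.* X ℚ.+ Y  ≡⟨ cong₂ (λ c z → c ℚ.* X ℚ.+ z) (s-periodic n) eY ⟩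
      c ℚ.* X ℚ.+ (μ ℚ.* Aprev s n ℚ.+ ν ℚ.* Bprev s n) ≡⟨ cong (λ z → c ℚ.* z ℚ.+ (μ ℚ.* Aprev s n ℚ.+ ν ℚ.* Bprev s n)) eX ⟩
      c ℚ.* (μ ℚ.* Aₙ s n ℚ.+ ν ℚ.* Bₙ s n) ℚ.+ (μ ℚ.* Aprev s n ℚ.+ ν ℚ.* Bprev s n)
        ≡⟨ solve 7 (λ c μ ν A B A' B' → c :* (μ :* A :+ ν :* B) :+ (μ :* A' :+ ν :* B') := μ :* (c :* A :+ A') :+ ν :* (c :* B :+ B'))
             refl c μ ν (Aₙ s n) (Bₙ s n) (Aprev s n) (Bprev s n) ⟩
      μ ℚ.* Aₙ s (suc n) ℚ.+ ν ℚ.* Bₙ s (suc n) ∎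
      where open ≡-Reasoning

  defect : ℚ → ℕ → ℚ
  defect D n = D ℚ.* (Aₙ s n ℚ.* Aₙ s n) ℚ.- Bₙ s n ℚ.* Bₙ s n

  -- By period-shift one period acts on (A, B) through [[α, β], [γ, α]], a matrix of
  -- determinant 1 preserving the form D A² − B² as soon as D β = γ.
  defect-periodic : ∀ D → D ℚ.* β ≡ γ → ∀ n → defect D (n ℕ.+ N) ≡ defect D n
  defect-periodic D Dβ≡γ n with period-shift n
  ... | eA , _ , eB , _ = begin
    defect D (n ℕ.+ N)
      ≡⟨ cong₂ (λ X Y → D ℚ.* (X ℚ.* X) ℚ.- Y ℚ.* Y) eA eB ⟩
    D ℚ.* ((α ℚ.* A ℚ.+ β ℚ.* B) ℚ.* (α ℚ.* A ℚ.+ β ℚ.* B)) ℚ.- (γ ℚ.* A ℚ.+ α ℚ.* B) ℚ.* (γ ℚ.* A ℚ.+ α ℚ.* B)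
      ≡⟨ solve 6 (λ D α β γ A B → D :* ((α :* A :+ β :* B) :* (α :* A :+ β :* B)) :- (γ :* A :+ α :* B) :* (γ :* A :+ α :* B)
             := (D :* (A :* A) :- B :* B) :+ (α :* α :- β :* γ :- con 1ℚ) :* (D :* (A :* A) :- B :* B)
                :+ (D :* β :- γ) :* (con (1ℚ ℚ.+ 1ℚ) :* α :* A :* B :+ β :* B :* B :+ γ :* A :* A)) refl D α β γ A B ⟩
    defect D n ℚ.+ (α ℚ.* α ℚ.- β ℚ.* γ ℚ.- 1ℚ) ℚ.* defect D n ℚ.+ (D ℚ.* β ℚ.- γ) ℚ.* W
      ≡⟨ cong₂ (λ X Y → defect D n ℚ.+ (X ℚ.- 1ℚ) ℚ.* defect D n ℚ.+ (Y ℚ.- γ) ℚ.* W) α²-βγ≡1 Dβ≡γ ⟩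
    defect D n ℚ.+ (1ℚ ℚ.- 1ℚ) ℚ.* defect D n ℚ.+ (γ ℚ.- γ) ℚ.* W
      ≡⟨ solve 3 (λ h g w → h :+ (con 1ℚ :- con 1ℚ) :* h :+ (g :- g) :* w := h) refl (defect D n) γ W ⟩
    defect D n ∎
    where
    open ≡-Reasoning
    A B W : ℚ
    A = Aₙ s n
    B = Bₙ s n
    W = (1ℚ ℚ.+ 1ℚ) ℚ.* α ℚ.* A ℚ.* B ℚ.+ β ℚ.* B ℚ.* B ℚ.+ γ ℚ.* A ℚ.* A

  defect-mod : ∀ D → D ℚ.* β ≡ γ → ∀ n → defect D n ≡ defect D (n % N)
  defect-mod D Dβ≡γ n = trans (cong (defect D) (m≡m%n+[m/n]*n n N)) (periods (n / N) (n % N))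
    where
    periods : ∀ q r → defect D (r ℕ.+ q ℕ.* N) ≡ defect D r
    periods zero    r = cong (defect D) (ℕP.+-identityʳ r)
    periods (suc q) r = begin
      defect D (r ℕ.+ (N ℕ.+ q ℕ.* N))  ≡⟨ cong (defect D) (trans (cong (r ℕ.+_) (ℕP.+-comm N (q ℕ.* N))) (sym (ℕP.+-assoc r (q ℕ.* N) N))) ⟩
      defect D (r ℕ.+ q ℕ.* N ℕ.+ N)    ≡⟨ defect-periodic D Dβ≡γ (r ℕ.+ q ℕ.* N) ⟩
      defect D (r ℕ.+ q ℕ.* N)          ≡⟨ periods q r ⟩
      defect D r                        ∎
      where open ≡-Reasoning

module _ (p : ℕ) (p-prime : Prime p) (2<p : 2 < p) where

  infix 9 p^_ p^ℤ_
  p^_ : ℕ → ℚ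
  p^ n = pℚ p ^ℚ n

  p^ℤ_ : ℕ → ℤ
  p^ℤ n = (+ p) ℤ.^ n

  p≢0 : p ≢ 0
  p≢0 e = ℕP.<⇒≢ (ℕP.<-trans (ℕ.s≤s ℕ.z≤n) 2<p) (sym e)

  instance
    p-nonZero : ℕ.NonZero p
    p-nonZero = ℕ.≢-nonZero p≢0

  p^≢0 : ∀ n → p^ n ≢ 0ℚ
  p^≢0 zero    ()
  p^≢0 (suc n) = *-≢0 (ι≢0 λ e → p≢0 (ℤP.+-injective e)) (p^≢0 n)

  p^-+ : ∀ m n → p^ (m ℕ.+ n) ≡ p^ m ℚ.* p^ n
  p^-+ zero    n = sym (ℚP.*-identityˡ (p^ n))
  p^-+ (suc m) n = trans (cong (pℚ p ℚ.*_) (p^-+ m n)) (sym (ℚP.*-assoc (pℚ p) (p^ m) (p^ n)))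

  p^≡ι : ∀ n → p^ n ≡ ι (p^ℤ n)
  p^≡ι zero    = refl
  p^≡ι (suc n) = trans (cong (pℚ p ℚ.*_) (p^≡ι n)) (sym (ι-homo-* (+ p) (p^ℤ n)))

  ι*p^ : ∀ a n → ι a ℚ.* p^ n ≡ ι (a ℤ.* p^ℤ n)
  ι*p^ a n = trans (cong (ι a ℚ.*_) (p^≡ι n)) (sym (ι-homo-* a (p^ℤ n)))

  p^ℤ≡+ : ∀ n → p^ℤ n ≡ + (p ℕ.^ n)
  p^ℤ≡+ zero    = refl
  p^ℤ≡+ (suc n) = trans (cong ((+ p) ℤ.*_) (p^ℤ≡+ n)) (sym (ℤP.pos-* p (p ℕ.^ n)))

  ∣p^ℤ∣ : ∀ e → ℤ.∣ p^ℤ e ∣ ≡ p ℕ.^ e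
  ∣p^ℤ∣ e = cong ℤ.∣_∣ (p^ℤ≡+ e)

  p^ℤ≢0 : ∀ e → p^ℤ e ≢ + 0
  p^ℤ≢0 e eq = ℕP.<⇒≢ (ℕP.m^n>0 p e) (sym (ℤP.+-injective (trans (sym (p^ℤ≡+ e)) eq)))

  p^-positive : ∀ n → ℚ.Positive (p^ n)
  p^-positive n = ℚ.positive (subst (0ℚ ℚ.<_) (sym (p^≡ι n))
    (ι-mono-< (subst (+ 0 ℤ.<_) (sym (p^ℤ≡+ n)) (ℤ.+<+ (ℕP.m^n>0 p n)))))

  ∣p^∣ : ∀ n → ℚ.∣ p^ n ∣ ≡ p^ n
  ∣p^∣ n = begin
    ℚ.∣ p^ n ∣              ≡⟨ cong ℚ.∣_∣ (p^≡ι n) ⟩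
    ℚ.∣ ι (p^ℤ n) ∣         ≡⟨ ∣ι∣ (p^ℤ n) ⟩
    ι (+ ℤ.∣ p^ℤ n ∣)       ≡⟨ cong (λ z → ι (+ ℤ.∣ z ∣)) (p^ℤ≡+ n) ⟩
    ι (+ (p ℕ.^ n))         ≡⟨ cong ι (sym (p^ℤ≡+ n)) ⟩
    ι (p^ℤ n)               ≡⟨ sym (p^≡ι n) ⟩
    p^ n                    ∎
    where open ≡-Reasoning

  p∤_ : ℤ → Set
  p∤ u = ¬ (+ p ℤD.∣ u)

  p∤-* : ∀ {u v} → p∤ u → p∤ v → p∤ (u ℤ.* v)
  p∤-* {u} {v} p∤u p∤v d with euclidsLemma ℤ.∣ u ∣ ℤ.∣ v ∣ p-prime (subst (p ℕD.∣_) (ℤP.abs-* u v) d)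
  ... | inj₁ p∣u = p∤u p∣u
  ... | inj₂ p∣v = p∤v p∣v

  p∤-+p* : ∀ {u} k → p∤ u → p∤ (u ℤ.+ k ℤ.* + p)
  p∤-+p* {u} k p∤u d =
    p∤u (ℤS.∣⇒∣ᵤ {+ p} {u} (ℤS.∣m+n∣n⇒∣m {+ p} {u} {k ℤ.* + p} (ℤS.∣ᵤ⇒∣ {+ p} d) (ℤS.divides k refl)))

  p∤1 : p∤ (+ 1)
  p∤1 d = ℕP.<⇒≱ (ℕP.<-trans (ℕ.s≤s (ℕ.s≤s ℕ.z≤n)) 2<p) (ℕD.∣⇒≤ d)

  p∤2 : p∤ (+ 2)
  p∤2 d = ℕP.<⇒≱ 2<p (ℕD.∣⇒≤ d)

  p∤-neg : ∀ {u} → p∤ u → p∤ (ℤ.- u)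
  p∤-neg {u} p∤u d = p∤u (subst (p ℕD.∣_) (ℤP.∣-i∣≡∣i∣ u) d)

  p∤⇒≢0 : ∀ {u} → p∤ u → u ≢ + 0
  p∤⇒≢0 p∤u refl = p∤u (ℕD._∣0 p)

  p∣-* : ∀ k {x} → + p ℤD.∣ x → + p ℤD.∣ (k ℤ.* x)
  p∣-* k {x} d = ℤS.∣⇒∣ᵤ (ℤS.∣n⇒∣m*n k (ℤS.∣ᵤ⇒∣ {+ p} {x} d))

  record Den≤ (e : ℕ) (x : ℚ) : Set where
    constructor den≤
    field
      num    : ℤ
      num-eq : x ℚ.* p^ e ≡ ι num

  record Den≡ (e : ℕ) (x : ℚ) : Set where
    constructor den≡
    field
      unit    : ℤ
      p∤unit  : p∤ unit
      unit-eq : x ℚ.* p^ e ≡ ι unit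

  Den≡⇒Den≤ : ∀ {e x} → Den≡ e x → Den≤ e x
  Den≡⇒Den≤ (den≡ u _ h) = den≤ u h

  Den≡⇒≢0 : ∀ {e x} → Den≡ e x → x ≢ 0ℚ
  Den≡⇒≢0 {e} (den≡ u p∤u h) refl = p∤⇒≢0 {u} p∤u (ι-injective (trans (sym h) (ℚP.*-zeroˡ (p^ e))))

  Den≡-2* : ∀ {e x} → Den≡ e x → Den≡ e (ι (+ 2) ℚ.* x)
  Den≡-2* {e} {x} (den≡ u p∤u h) = den≡ (+ 2 ℤ.* u) (p∤-* {+ 2} {u} p∤2 p∤u)
    (trans (ℚP.*-assoc (ι (+ 2)) x (p^ e)) (trans (cong (ι (+ 2) ℚ.*_) h) (sym (ι-homo-* (+ 2) u))))

  Den≤-ι : ∀ z → Den≤ 0 (ι z)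
  Den≤-ι z = den≤ z (ℚP.*-identityʳ (ι z))

  Den≤-+ : ∀ {e x y} → Den≤ e x → Den≤ e y → Den≤ e (x ℚ.+ y)
  Den≤-+ {e} {x} {y} (den≤ z h) (den≤ w k) =
    den≤ (z ℤ.+ w) (trans (ℚP.*-distribʳ-+ (p^ e) x y) (trans (cong₂ ℚ._+_ h k) (sym (ι-homo-+ z w))))

  Den≤-neg : ∀ {e x} → Den≤ e x → Den≤ e (ℚ.- x)
  Den≤-neg {e} {x} (den≤ z h) =
    den≤ (ℤ.- z) (trans (sym (ℚP.neg-distribˡ-* x (p^ e))) (trans (cong ℚ.-_ h) (sym (ι-homo‿- z))))

  Den≤-* : ∀ {e f x y} → Den≤ e x → Den≤ f y → Den≤ (e ℕ.+ f) (x ℚ.* y)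
  Den≤-* {e} {f} {x} {y} (den≤ z h) (den≤ w k) = den≤ (z ℤ.* w) (begin
    (x ℚ.* y) ℚ.* p^ (e ℕ.+ f)      ≡⟨ cong ((x ℚ.* y) ℚ.*_) (p^-+ e f) ⟩
    (x ℚ.* y) ℚ.* (p^ e ℚ.* p^ f)   ≡⟨ solve 4 (λ x y a b → (x :* y) :* (a :* b) := (x :* a) :* (y :* b)) refl x y (p^ e) (p^ f) ⟩
    (x ℚ.* p^ e) ℚ.* (y ℚ.* p^ f)   ≡⟨ cong₂ ℚ._*_ h k ⟩
    ι z ℚ.* ι w                     ≡⟨ sym (ι-homo-* z w) ⟩
    ι (z ℤ.* w)                     ∎)
    where open ≡-Reasoning

  Den≤-mono : ∀ {e f x} → e ≤ f → Den≤ e x → Den≤ f x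
  Den≤-mono {e} {f} {x} e≤f (den≤ z h) with ℕP.m≤n⇒∃[o]m+o≡n e≤f
  ... | d , refl = den≤ (z ℤ.* p^ℤ d) (begin
    x ℚ.* p^ (e ℕ.+ d)          ≡⟨ cong (x ℚ.*_) (p^-+ e d) ⟩
    x ℚ.* (p^ e ℚ.* p^ d)       ≡⟨ sym (ℚP.*-assoc x (p^ e) (p^ d)) ⟩
    (x ℚ.* p^ e) ℚ.* p^ d       ≡⟨ cong (ℚ._* p^ d) h ⟩
    ι z ℚ.* p^ d                ≡⟨ ι*p^ z d ⟩
    ι (z ℤ.* p^ℤ d)             ∎)
    where open ≡-Reasoning

  ValGe-+ : ∀ {N x y} → ValGe p N x → ValGe p N y → ValGe p N (x ℚ.+ y)
  ValGe-+ {N} {x} {y} (u₁ , w₁ , p∤w₁ , h₁) (u₂ , w₂ , p∤w₂ , h₂) =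
    u₁ ℤ.* w₂ ℤ.+ u₂ ℤ.* w₁ , w₁ ℤ.* w₂ , p∤-* {w₁} {w₂} p∤w₁ p∤w₂ , (begin
      (x ℚ.+ y) ℚ.* ι (w₁ ℤ.* w₂)                              ≡⟨ cong ((x ℚ.+ y) ℚ.*_) (ι-homo-* w₁ w₂) ⟩
      (x ℚ.+ y) ℚ.* (ι w₁ ℚ.* ι w₂)                            ≡⟨ solve 4 (λ x y a b → (x :+ y) :* (a :* b) := (x :* a) :* b :+ (y :* b) :* a) refl x y (ι w₁) (ι w₂) ⟩
      (x ℚ.* ι w₁) ℚ.* ι w₂ ℚ.+ (y ℚ.* ι w₂) ℚ.* ι w₁          ≡⟨ cong₂ (λ A B → A ℚ.* ι w₂ ℚ.+ B ℚ.* ι w₁) h₁ h₂ ⟩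
      (ι u₁ ℚ.* p^ N) ℚ.* ι w₂ ℚ.+ (ι u₂ ℚ.* p^ N) ℚ.* ι w₁    ≡⟨ solve 5 (λ a b c d q → (a :* q) :* c :+ (b :* q) :* d := (a :* c :+ b :* d) :* q) refl (ι u₁) (ι u₂) (ι w₂) (ι w₁) (p^ N) ⟩
      (ι u₁ ℚ.* ι w₂ ℚ.+ ι u₂ ℚ.* ι w₁) ℚ.* p^ N               ≡⟨ cong (ℚ._* p^ N) (sym (ι-homo-*+* u₁ w₂ u₂ w₁)) ⟩
      ι (u₁ ℤ.* w₂ ℤ.+ u₂ ℤ.* w₁) ℚ.* p^ N                     ∎)
    where open ≡-Reasoning

  ValGe-* : ∀ {N M x y} → ValGe p N x → ValGe p M y → ValGe p (N ℕ.+ M) (x ℚ.* y)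
  ValGe-* {N} {M} {x} {y} (u₁ , w₁ , p∤w₁ , h₁) (u₂ , w₂ , p∤w₂ , h₂) =
    u₁ ℤ.* u₂ , w₁ ℤ.* w₂ , p∤-* {w₁} {w₂} p∤w₁ p∤w₂ , (begin
      (x ℚ.* y) ℚ.* ι (w₁ ℤ.* w₂)              ≡⟨ cong ((x ℚ.* y) ℚ.*_) (ι-homo-* w₁ w₂) ⟩
      (x ℚ.* y) ℚ.* (ι w₁ ℚ.* ι w₂)            ≡⟨ solve 4 (λ x y a b → (x :* y) :* (a :* b) := (x :* a) :* (y :* b)) refl x y (ι w₁) (ι w₂) ⟩
      (x ℚ.* ι w₁) ℚ.* (y ℚ.* ι w₂)            ≡⟨ cong₂ ℚ._*_ h₁ h₂ ⟩
      (ι u₁ ℚ.* p^ N) ℚ.* (ι u₂ ℚ.* p^ M)      ≡⟨ solve 4 (λ a b c d → (a :* c) :* (b :* d) := (a :* b) :* (c :* d)) refl (ι u₁) (ι u₂) (p^ N) (p^ M) ⟩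
      (ι u₁ ℚ.* ι u₂) ℚ.* (p^ N ℚ.* p^ M)      ≡⟨ cong₂ ℚ._*_ (sym (ι-homo-* u₁ u₂)) (sym (p^-+ N M)) ⟩
      ι (u₁ ℤ.* u₂) ℚ.* p^ (N ℕ.+ M)           ∎)
    where open ≡-Reasoning

  ValGe-mono : ∀ {N M x} → M ≤ N → ValGe p N x → ValGe p M x
  ValGe-mono {N} {M} {x} M≤N (u , w , p∤w , h) with ℕP.m≤n⇒∃[o]m+o≡n M≤N
  ... | d , refl = u ℤ.* p^ℤ d , w , p∤w , (begin
    x ℚ.* ι w                      ≡⟨ h ⟩
    ι u ℚ.* p^ (M ℕ.+ d)           ≡⟨ cong (ι u ℚ.*_) (trans (p^-+ M d) (ℚP.*-comm (p^ M) (p^ d))) ⟩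
    ι u ℚ.* (p^ d ℚ.* p^ M)        ≡⟨ sym (ℚP.*-assoc (ι u) (p^ d) (p^ M)) ⟩
    (ι u ℚ.* p^ d) ℚ.* p^ M        ≡⟨ cong (ℚ._* p^ M) (ι*p^ u d) ⟩
    ι (u ℤ.* p^ℤ d) ℚ.* p^ M       ∎)
    where open ≡-Reasoning

  ValGe-0 : ∀ {N} → ValGe p N 0ℚ
  ValGe-0 {N} = + 0 , + 1 , p∤1 , trans (ℚP.*-zeroˡ (ι (+ 1))) (sym (ℚP.*-zeroˡ (p^ N)))

  ValGe-neg : ∀ {N x} → ValGe p N x → ValGe p N (ℚ.- x)
  ValGe-neg {N} {x} (u , w , p∤w , h) = ℤ.- u , w , p∤w , (begin
    ℚ.- x ℚ.* ι w        ≡⟨ sym (ℚP.neg-distribˡ-* x (ι w)) ⟩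
    ℚ.- (x ℚ.* ι w)      ≡⟨ cong ℚ.-_ h ⟩
    ℚ.- (ι u ℚ.* p^ N)   ≡⟨ ℚP.neg-distribˡ-* (ι u) (p^ N) ⟩
    ℚ.- ι u ℚ.* p^ N     ≡⟨ cong (ℚ._* p^ N) (sym (ι-homo‿- u)) ⟩
    ι (ℤ.- u) ℚ.* p^ N   ∎)
    where open ≡-Reasoning

  ValGe-ι : ∀ z → ValGe p 0 (ι z)
  ValGe-ι z = z , + 1 , p∤1 , refl

  ValGe-inverse : ∀ {e x y} → x ℚ.* y ≡ 1ℚ → Den≡ e x → ValGe p e y
  ValGe-inverse {e} {x} {y} xy≡1 (den≡ u p∤u h) = + 1 , u , p∤u , (begin
    y ℚ.* ι u             ≡⟨ cong (y ℚ.*_) (sym h) ⟩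
    y ℚ.* (x ℚ.* p^ e)    ≡⟨ solve 3 (λ x y q → y :* (x :* q) := (x :* y) :* q) refl x y (p^ e) ⟩
    (x ℚ.* y) ℚ.* p^ e    ≡⟨ cong (ℚ._* p^ e) xy≡1 ⟩
    1ℚ ℚ.* p^ e           ∎)
    where open ≡-Reasoning

  ValGe-Den≤-* : ∀ {N e x y} → Den≤ e x → ValGe p (N ℕ.+ e) y → ValGe p N (x ℚ.* y)
  ValGe-Den≤-* {N} {e} {x} {y} (den≤ z hz) (u , w , p∤w , h) = z ℤ.* u , w , p∤w , (begin
    (x ℚ.* y) ℚ.* ι w                 ≡⟨ ℚP.*-assoc x y (ι w) ⟩
    x ℚ.* (y ℚ.* ι w)                 ≡⟨ cong (x ℚ.*_) h ⟩
    x ℚ.* (ι u ℚ.* p^ (N ℕ.+ e))      ≡⟨ cong (λ q → x ℚ.* (ι u ℚ.* q)) (p^-+ N e) ⟩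
    x ℚ.* (ι u ℚ.* (p^ N ℚ.* p^ e))   ≡⟨ solve 4 (λ x u a b → x :* (u :* (a :* b)) := ((x :* b) :* u) :* a) refl x (ι u) (p^ N) (p^ e) ⟩
    ((x ℚ.* p^ e) ℚ.* ι u) ℚ.* p^ N   ≡⟨ cong (λ q → (q ℚ.* ι u) ℚ.* p^ N) hz ⟩
    (ι z ℚ.* ι u) ℚ.* p^ N            ≡⟨ cong (ℚ._* p^ N) (sym (ι-homo-* z u)) ⟩
    ι (z ℤ.* u) ℚ.* p^ N              ∎)
    where open ≡-Reasoning

  exact-denominator : ∀ {x} → InZ1p p x → PAbsGt1 p x → ∃ λ k → 1 ≤ k × Den≡ k x
  exact-denominator {x} (n , z , e) |x|>1 = go n z e
    where
    go : ∀ n z → x ℚ.* p^ n ≡ ι z → ∃ λ k → 1 ≤ k × Den≡ k x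
    go zero    z e = ⊥-elim (|x|>1 (z , + 1 , p∤1 , trans e (sym (ℚP.*-identityʳ (ι z)))))
    go (suc n) z e with ℕD._∣?_ p ℤ.∣ z ∣
    ... | no p∤z = suc n , ℕ.s≤s ℕ.z≤n , den≡ z p∤z e
    ... | yes p∣z with ℤS.∣ᵤ⇒∣ {+ p} {z} p∣z
    ...   | ℤS.divides q z≡qp = go n q (*-cancelʳ-≢0 (p^≢0 1) (begin
          (x ℚ.* p^ n) ℚ.* p^ 1   ≡⟨ solve 3 (λ x a b → (x :* a) :* (b :* con 1ℚ) := x :* (b :* a)) refl x (p^ n) (pℚ p) ⟩
          x ℚ.* p^ (suc n)        ≡⟨ e ⟩
          ι z                     ≡⟨ cong ι z≡qp ⟩
          ι (q ℤ.* + p)           ≡⟨ ι-homo-* q (+ p) ⟩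
          ι q ℚ.* pℚ p            ≡⟨ cong (ι q ℚ.*_) (sym (ℚP.*-identityʳ (pℚ p))) ⟩
          ι q ℚ.* p^ 1            ∎))
      where open ≡-Reasoning

  Vp-neg⇒Den≡ : ∀ {x} k → PAbsGt1 p x → Vp p x (ℤ.- (+ k)) → 1 ≤ k × Den≡ k x
  Vp-neg⇒Den≡ {x} zero    |x|>1 (w , _ , x≡w) = ⊥-elim (|x|>1 (w , + 1 , p∤1 , trans (ℚP.*-identityʳ x) x≡w))
  Vp-neg⇒Den≡     (suc k) _     (w , p∤w , x≡) = ℕ.s≤s ℕ.z≤n , den≡ w p∤w x≡

  module LargeQuotients (s : ℕ → ℚ) (large : ∀ i → Σ ℕ λ k → 1 ≤ k × Den≡ k (s (suc i))) where

    denExp : ℕ → ℕ → ℕ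
    denExp e₀ zero    = e₀
    denExp e₀ (suc n) = denExp e₀ n ℕ.+ proj₁ (large n)

    denExp-≥ : ∀ e₀ n → e₀ ℕ.+ n ≤ denExp e₀ n
    denExp-≥ e₀ zero    = ℕP.≤-reflexive (ℕP.+-identityʳ e₀)
    denExp-≥ e₀ (suc n) = begin
      e₀ ℕ.+ suc n                   ≡⟨ ℕP.+-suc e₀ n ⟩
      suc (e₀ ℕ.+ n)                 ≡⟨ ℕP.+-comm 1 (e₀ ℕ.+ n) ⟩
      e₀ ℕ.+ n ℕ.+ 1                 ≤⟨ ℕP.+-mono-≤ (denExp-≥ e₀ n) (proj₁ (proj₂ (large n))) ⟩
      denExp e₀ n ℕ.+ proj₁ (large n) ∎
      where open ℕP.≤-Reasoning

    denExp-mono : ∀ e₀ {m n} → m ≤ n → denExp e₀ m ≤ denExp e₀ n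
    denExp-mono e₀ {m} m≤n with ℕP.m≤n⇒∃[o]m+o≡n m≤n
    ... | d , refl = go d
      where
      go : ∀ d → denExp e₀ m ≤ denExp e₀ (m ℕ.+ d)
      go zero    = ℕP.≤-reflexive (cong (denExp e₀) (sym (ℕP.+-identityʳ m)))
      go (suc d) rewrite ℕP.+-suc m d = ℕP.≤-trans (go d) (ℕP.m≤m+n _ _)

    denExp-shift : ∀ e₀ n → denExp e₀ n ≡ e₀ ℕ.+ denExp 0 n
    denExp-shift e₀ zero    = sym (ℕP.+-identityʳ e₀)
    denExp-shift e₀ (suc n) =
      trans (cong (ℕ._+ proj₁ (large n)) (denExp-shift e₀ n)) (ℕP.+-assoc e₀ (denExp 0 n) (proj₁ (large n)))

    -- Multiplying by s (n+1), whose denominator is exactly p^k with k ≥ 1, adds k to the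
    -- exponent of the denominator; the second term of the recurrence is p-adically smaller.
    recurrence-denominators :
      (X X' : ℕ → ℚ) → (∀ n → X (suc n) ≡ s (suc n) ℚ.* X n ℚ.+ X' n) → (∀ n → X' (suc n) ≡ X n) →
      ∀ e₀ → Den≡ e₀ (X 0) → Den≤ e₀ (X' 0) → ∀ n → Den≡ (denExp e₀ n) (X n) × Den≤ (denExp e₀ n) (X' n)
    recurrence-denominators X X' eX eX' e₀ h₀ h₀' zero = h₀ , h₀'
    recurrence-denominators X X' eX eX' e₀ h₀ h₀' (suc n)
      with recurrence-denominators X X' eX eX' e₀ h₀ h₀' n | large n
    ... | den≡ u p∤u hu , den≤ z hz | suc k , _ , den≡ v p∤v hv =
      den≡ (v ℤ.* u ℤ.+ z' ℤ.* + p) (p∤-+p* {v ℤ.* u} z' (p∤-* {v} {u} p∤v p∤u)) new ,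
      den≤ (u ℤ.* p^ℤ suc k) old
      where
      e : ℕ
      e = denExp e₀ n
      z' : ℤ
      z' = z ℤ.* p^ℤ k
      open ≡-Reasoning
      new : X (suc n) ℚ.* p^ (e ℕ.+ suc k) ≡ ι (v ℤ.* u ℤ.+ z' ℤ.* + p)
      new = begin
        X (suc n) ℚ.* p^ (e ℕ.+ suc k)
          ≡⟨ cong₂ ℚ._*_ (eX n) (p^-+ e (suc k)) ⟩
        (s (suc n) ℚ.* X n ℚ.+ X' n) ℚ.* (p^ e ℚ.* (pℚ p ℚ.* p^ k))
          ≡⟨ solve 6 (λ a x y q r t → (a :* x :+ y) :* (q :* (r :* t)) := (a :* (r :* t)) :* (x :* q) :+ ((y :* q) :* t) :* r)
               refl (s (suc n)) (X n) (X' n) (p^ e) (pℚ p) (p^ k) ⟩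
        (s (suc n) ℚ.* p^ (suc k)) ℚ.* (X n ℚ.* p^ e) ℚ.+ ((X' n ℚ.* p^ e) ℚ.* p^ k) ℚ.* pℚ p
          ≡⟨ cong₂ (λ A B → A ℚ.* B ℚ.+ (X' n ℚ.* p^ e ℚ.* p^ k) ℚ.* pℚ p) hv hu ⟩
        ι v ℚ.* ι u ℚ.+ (X' n ℚ.* p^ e ℚ.* p^ k) ℚ.* pℚ p
          ≡⟨ cong (λ C → ι v ℚ.* ι u ℚ.+ (C ℚ.* p^ k) ℚ.* pℚ p) hz ⟩
        ι v ℚ.* ι u ℚ.+ (ι z ℚ.* p^ k) ℚ.* pℚ p
          ≡⟨ cong (λ w → ι v ℚ.* ι u ℚ.+ w ℚ.* pℚ p) (ι*p^ z k) ⟩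
        ι v ℚ.* ι u ℚ.+ ι z' ℚ.* ι (+ p)
          ≡⟨ sym (ι-homo-*+* v u z' (+ p)) ⟩
        ι (v ℤ.* u ℤ.+ z' ℤ.* + p) ∎
      old : X' (suc n) ℚ.* p^ (e ℕ.+ suc k) ≡ ι (u ℤ.* p^ℤ suc k)
      old = begin
        X' (suc n) ℚ.* p^ (e ℕ.+ suc k)    ≡⟨ cong₂ ℚ._*_ (eX' n) (p^-+ e (suc k)) ⟩
        X n ℚ.* (p^ e ℚ.* p^ (suc k))      ≡⟨ sym (ℚP.*-assoc (X n) (p^ e) (p^ (suc k))) ⟩
        (X n ℚ.* p^ e) ℚ.* p^ (suc k)      ≡⟨ cong (ℚ._* p^ (suc k)) hu ⟩
        ι u ℚ.* p^ (suc k)                 ≡⟨ ι*p^ u (suc k) ⟩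
        ι (u ℤ.* p^ℤ suc k)                ∎

    A-denominators : ∀ {k₀} → Den≡ k₀ (s 0) → ∀ n →
                     Den≡ (denExp k₀ n) (Aₙ s n) × Den≤ (denExp k₀ n) (Aprev s n)
    A-denominators {k₀} h₀ = recurrence-denominators (Aₙ s) (Aprev s) (λ _ → refl) (λ _ → refl) k₀ h₀
      (den≤ (p^ℤ k₀) (trans (ℚP.*-identityˡ (p^ k₀)) (p^≡ι k₀)))

    B-denominators : ∀ n → Den≡ (denExp 0 n) (Bₙ s n) × Den≤ (denExp 0 n) (Bprev s n)
    B-denominators = recurrence-denominators (Bₙ s) (Bprev s) (λ _ → refl) (λ _ → refl) 0
      (den≡ (+ 1) p∤1 refl) (den≤ (+ 0) refl)

    B≢0 : ∀ n → Bₙ s n ≢ 0ℚ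
    B≢0 n = Den≡⇒≢0 (proj₁ (B-denominators n))

    B⁻¹ : ℕ → ℚ
    B⁻¹ n = ℚ.1/_ (Bₙ s n) {{ℚ.≢-nonZero (B≢0 n)}}

    B*B⁻¹ : ∀ n → Bₙ s n ℚ.* B⁻¹ n ≡ 1ℚ
    B*B⁻¹ n = ℚP.*-inverseʳ (Bₙ s n) {{ℚ.≢-nonZero (B≢0 n)}}

    convergent≡ : ∀ n → convergent s n ≡ Aₙ s n ℚ.* B⁻¹ n
    convergent≡ n with Bₙ s n ℚ.≟ 0ℚ
    ... | yes B≡0 = ⊥-elim (B≢0 n B≡0)
    ... | no  _   = refl

    ValGe-B⁻¹ : ∀ n → ValGe p (denExp 0 n) (B⁻¹ n)
    ValGe-B⁻¹ n = ValGe-inverse (B*B⁻¹ n) (proj₁ (B-denominators n))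

    ValGe-B⁻² : ∀ n → ValGe p (denExp 0 n ℕ.+ denExp 0 n) (B⁻¹ n ℚ.* B⁻¹ n)
    ValGe-B⁻² n = ValGe-* {denExp 0 n} {denExp 0 n} {B⁻¹ n} {B⁻¹ n} (ValGe-B⁻¹ n) (ValGe-B⁻¹ n)

    convergent-step : ∀ n → convergent s (suc n) ℚ.- convergent s n ≡ convDet s (suc n) ℚ.* (B⁻¹ n ℚ.* B⁻¹ (suc n))
    convergent-step n = begin
      convergent s (suc n) ℚ.- convergent s n
        ≡⟨ cong₂ ℚ._-_ (convergent≡ (suc n)) (convergent≡ n) ⟩
      A₁ ℚ.* y₁ ℚ.- A₀ ℚ.* y₀
        ≡⟨ solve 6 (λ A₁ A₀ y₁ y₀ B₁ B₀ → A₁ :* y₁ :- A₀ :* y₀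
                   := (A₁ :* B₀ :- A₀ :* B₁) :* (y₀ :* y₁) :- A₁ :* y₁ :* (B₀ :* y₀ :- con 1ℚ) :+ A₀ :* y₀ :* (B₁ :* y₁ :- con 1ℚ))
             refl A₁ A₀ y₁ y₀ (Bₙ s (suc n)) (Bₙ s n) ⟩
      d ℚ.* (y₀ ℚ.* y₁) ℚ.- A₁ ℚ.* y₁ ℚ.* (Bₙ s n ℚ.* y₀ ℚ.- 1ℚ) ℚ.+ A₀ ℚ.* y₀ ℚ.* (Bₙ s (suc n) ℚ.* y₁ ℚ.- 1ℚ)
        ≡⟨ cong₂ (λ b b' → d ℚ.* (y₀ ℚ.* y₁) ℚ.- A₁ ℚ.* y₁ ℚ.* (b ℚ.- 1ℚ) ℚ.+ A₀ ℚ.* y₀ ℚ.* (b' ℚ.- 1ℚ)) (B*B⁻¹ n) (B*B⁻¹ (suc n)) ⟩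
      d ℚ.* (y₀ ℚ.* y₁) ℚ.- A₁ ℚ.* y₁ ℚ.* (1ℚ ℚ.- 1ℚ) ℚ.+ A₀ ℚ.* y₀ ℚ.* (1ℚ ℚ.- 1ℚ)
        ≡⟨ solve 3 (λ d a b → d :- a :* (con 1ℚ :- con 1ℚ) :+ b :* (con 1ℚ :- con 1ℚ) := d) refl (d ℚ.* (y₀ ℚ.* y₁)) (A₁ ℚ.* y₁) (A₀ ℚ.* y₀) ⟩
      d ℚ.* (y₀ ℚ.* y₁) ∎
      where
      open ≡-Reasoning
      A₁ A₀ y₁ y₀ d : ℚ
      A₁ = Aₙ s (suc n)
      A₀ = Aₙ s n
      y₁ = B⁻¹ (suc n)
      y₀ = B⁻¹ n
      d  = convDet s (suc n)

    ValGe-convDet : ∀ n → ValGe p 0 (convDet s n)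
    ValGe-convDet n with convDet-±1 s n
    ... | inj₁ e = subst (ValGe p 0) (sym e) (ValGe-ι (+ 1))
    ... | inj₂ e = subst (ValGe p 0) (sym e) (ValGe-ι (ℤ.- (+ 1)))

    ValGe-step : ∀ N n → N ≤ n → ValGe p N (convergent s (suc n) ℚ.- convergent s n)
    ValGe-step N n N≤n = subst (ValGe p N) (sym (convergent-step n))
      (ValGe-mono {0 ℕ.+ (e ℕ.+ e')} {N} {convDet s (suc n) ℚ.* (B⁻¹ n ℚ.* B⁻¹ (suc n))}
        (ℕP.≤-trans N≤n (ℕP.≤-trans (denExp-≥ 0 n) (ℕP.m≤m+n e e')))
        (ValGe-* {0} {e ℕ.+ e'} {convDet s (suc n)} (ValGe-convDet (suc n))
          (ValGe-* {e} {e'} {B⁻¹ n} (ValGe-B⁻¹ n) (ValGe-B⁻¹ (suc n)))))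
      where
      e e' : ℕ
      e  = denExp 0 n
      e' = denExp 0 (suc n)

    ValGe-tail : ∀ N n d → N ≤ n → ValGe p N (convergent s (n ℕ.+ d) ℚ.- convergent s n)
    ValGe-tail N n zero N≤n rewrite ℕP.+-identityʳ n =
      subst (ValGe p N) (sym (ℚP.+-inverseʳ (convergent s n))) (ValGe-0 {N})
    ValGe-tail N n (suc d) N≤n rewrite ℕP.+-suc n d =
      subst (ValGe p N) (solve 3 (λ a b c → (a :- b) :+ (b :- c) := a :- c) refl x y (convergent s n))
        (ValGe-+ {N} {x ℚ.- y} {y ℚ.- convergent s n} (ValGe-step N (n ℕ.+ d) (ℕP.≤-trans N≤n (ℕP.m≤m+n n d))) (ValGe-tail N n d N≤n))
      where
      x y : ℚ
      x = convergent s (suc (n ℕ.+ d))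
      y = convergent s (n ℕ.+ d)

    convergents-cauchy : ∀ N → ∃ λ n₁ → ∀ n n' → n₁ ≤ n → n₁ ≤ n' →
                         ValGe p N (convergent s n ℚ.- convergent s n')
    convergents-cauchy N = N , go
      where
      go : ∀ n n' → N ≤ n → N ≤ n' → ValGe p N (convergent s n ℚ.- convergent s n')
      go n n' N≤n N≤n' with ℕP.≤-total n n'
      ... | inj₂ n'≤n with ℕP.m≤n⇒∃[o]m+o≡n n'≤n
      ...   | d , refl = ValGe-tail N n' d N≤n'
      go n n' N≤n N≤n' | inj₁ n≤n' with ℕP.m≤n⇒∃[o]m+o≡n n≤n'
      ...   | d , refl = subst (ValGe p N) (solve 2 (λ a b → :- (a :- b) := b :- a) refl (convergent s (n ℕ.+ d)) (convergent s n))
                           (ValGe-neg {N} {convergent s (n ℕ.+ d) ℚ.- convergent s n} (ValGe-tail N n d N≤n))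

  module PeriodicConvergence (a : ℕ → ℚ) (x : ℚ) (u : ℕ)
    (a-large : ∀ i → 1 ≤ i → i ≤ u → Σ ℕ λ k → 1 ≤ k × Den≡ k (a i))
    (x-large : Σ ℕ λ k → 1 ≤ k × Den≡ k x)
    {k₀ : ℕ} (1≤k₀ : 1 ≤ k₀) (a₀-den : Den≡ k₀ (a 0)) where

    open Periodic a x u public

    s-large : ∀ i → Σ ℕ λ k → 1 ≤ k × Den≡ k (s (suc i))
    s-large i with periodBlock-cases a x u (i % N)
    ... | inj₁ (j , 1≤j , j≤u , e) = let k , 1≤k , h = a-large j 1≤j j≤u in k , 1≤k , subst (Den≡ k) (sym e) h
    ... | inj₂ (inj₁ e)             = let k , 1≤k , h = x-large in k , 1≤k , subst (Den≡ k) (sym e) h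
    ... | inj₂ (inj₂ e)             = k₀ , 1≤k₀ , subst (Den≡ k₀) (sym e) (Den≡-2* a₀-den)

    open LargeQuotients s s-large public

    defectExp : ℕ → ℕ
    defectExp n = denExp k₀ n ℕ.+ denExp k₀ n

    defect-Den≤ : ∀ d n → Den≤ (defectExp n) (defect (ι d) n)
    defect-Den≤ d n = Den≤-+ (subst (λ k → Den≤ k (ι d ℚ.* (Aₙ s n ℚ.* Aₙ s n))) (ℕP.+-identityˡ (defectExp n)) (Den≤-* (Den≤-ι d) (Den≤-* A-den A-den)))
                             (Den≤-neg (Den≤-mono (ℕP.+-mono-≤ B≤A B≤A) (Den≤-* B-den B-den)))
      where
      A-den : Den≤ (denExp k₀ n) (Aₙ s n)
      A-den = Den≡⇒Den≤ (proj₁ (A-denominators a₀-den n))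
      B-den : Den≤ (denExp 0 n) (Bₙ s n)
      B-den = Den≡⇒Den≤ (proj₁ (B-denominators n))
      B≤A : denExp 0 n ≤ denExp k₀ n
      B≤A = subst (denExp 0 n ≤_) (sym (denExp-shift k₀ n)) (ℕP.m≤n+m (denExp 0 n) k₀)

    defect-Den≤-uniform : ∀ d → ι d ℚ.* β ≡ γ → ∀ n → Den≤ (defectExp N) (defect (ι d) n)
    defect-Den≤-uniform d dβ≡γ n = subst (Den≤ (defectExp N)) (sym (defect-mod (ι d) dβ≡γ n))
      (Den≤-mono (ℕP.+-mono-≤ n%N≤N n%N≤N) (defect-Den≤ d (n % N)))
      where
      n%N≤N : denExp k₀ (n % N) ≤ denExp k₀ N
      n%N≤N = denExp-mono k₀ (ℕP.<⇒≤ (m%n<n n N))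

    defect-convergent : ∀ D n → D ℚ.* (convergent s n ^ℚ 2) ℚ.- 1ℚ ≡ defect D n ℚ.* (B⁻¹ n ℚ.* B⁻¹ n)
    defect-convergent D n = begin
      D ℚ.* (convergent s n ℚ.* (convergent s n ℚ.* 1ℚ)) ℚ.- 1ℚ
        ≡⟨ cong (λ c → D ℚ.* (c ℚ.* (c ℚ.* 1ℚ)) ℚ.- 1ℚ) (convergent≡ n) ⟩
      D ℚ.* ((A ℚ.* y) ℚ.* ((A ℚ.* y) ℚ.* 1ℚ)) ℚ.- 1ℚ
        ≡⟨ solve 4 (λ D A B y → D :* ((A :* y) :* ((A :* y) :* con 1ℚ)) :- con 1ℚ
                              := (D :* (A :* A) :- B :* B) :* (y :* y) :+ ((B :* y) :* (B :* y) :- con 1ℚ)) refl D A B y ⟩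
      defect D n ℚ.* (y ℚ.* y) ℚ.+ ((B ℚ.* y) ℚ.* (B ℚ.* y) ℚ.- 1ℚ)
        ≡⟨ cong (λ z → defect D n ℚ.* (y ℚ.* y) ℚ.+ (z ℚ.* z ℚ.- 1ℚ)) (B*B⁻¹ n) ⟩
      defect D n ℚ.* (y ℚ.* y) ℚ.+ (1ℚ ℚ.* 1ℚ ℚ.- 1ℚ)
        ≡⟨ solve 1 (λ z → z :+ (con 1ℚ :* con 1ℚ :- con 1ℚ) := z) refl (defect D n ℚ.* (y ℚ.* y)) ⟩
      defect D n ℚ.* (y ℚ.* y) ∎
      where
      open ≡-Reasoning
      A B y : ℚ
      A = Aₙ s n
      B = Bₙ s n
      y = B⁻¹ n

    -- The defect is bounded p-adically while B_n⁻² → 0.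
    converges : ∀ k m → ι (p^ℤ (2 ℕ.* k) ℤ.* m) ℚ.* β ≡ γ → ConvergesToInvPowSqrt p s k m
    converges k m Dβ≡γ = (0 , λ n _ → B≢0 n) , convergents-cauchy , λ M → M ℕ.+ defectExp N , λ n M+exp≤n →
      subst (ValGe p M) (sym (defect-convergent D n))
        (ValGe-Den≤-* {M} {defectExp N} {defect D n} {B⁻¹ n ℚ.* B⁻¹ n} (defect-Den≤-uniform d Dβ≡γ n)
          (ValGe-mono {denExp 0 n ℕ.+ denExp 0 n} {M ℕ.+ defectExp N} {B⁻¹ n ℚ.* B⁻¹ n}
            (ℕP.≤-trans M+exp≤n (ℕP.≤-trans (denExp-≥ 0 n) (ℕP.m≤m+n (denExp 0 n) (denExp 0 n))))
            (ValGe-B⁻² n)))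
      where
      d : ℤ
      d = p^ℤ (2 ℕ.* k) ℤ.* m
      D : ℚ
      D = ι d

  n<p^n : ∀ n → n < p ℕ.^ n
  n<p^n zero    = ℕP.≤-refl
  n<p^n (suc n) = begin-strict
    suc n                        ≡⟨ ℕP.+-comm 1 n ⟩
    n ℕ.+ 1                      <⟨ ℕP.+-mono-<-≤ (n<p^n n) (ℕP.m^n>0 p n) ⟩
    p ℕ.^ n ℕ.+ p ℕ.^ n          ≡⟨ cong (p ℕ.^ n ℕ.+_) (sym (ℕP.+-identityʳ (p ℕ.^ n))) ⟩
    2 ℕ.* p ℕ.^ n                ≤⟨ ℕP.*-monoˡ-≤ (p ℕ.^ n) (ℕP.<⇒≤ 2<p) ⟩
    p ℕ.^ suc n                  ∎
    where open ℕP.≤-Reasoning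

  p∤⇒coprime : ∀ a → p∤ a → Coprime ℤ.∣ a ∣ p
  p∤⇒coprime a p∤a {d} (d∣a , d∣p) with prime⇒irreducible p-prime d∣p
  ... | inj₁ d≡1 = d≡1
  ... | inj₂ refl = ⊥-elim (p∤a d∣a)

  coprime-∣-p^* : ∀ e {m X} → Coprime m p → m ℕD.∣ p ℕ.^ e ℕ.* X → m ℕD.∣ X
  coprime-∣-p^* zero    {m} {X} _   d = subst (m ℕD.∣_) (ℕP.+-identityʳ X) d
  coprime-∣-p^* (suc e) {m} {X} m⊥p d =
    coprime-∣-p^* e m⊥p (coprime-divisor m⊥p (subst (m ℕD.∣_) (ℕP.*-assoc p (p ℕ.^ e) X) d))

  p∤-∣-p^ℤ* : ∀ {a X} e → p∤ a → a ℤS.∣ p^ℤ e ℤ.* X → a ℤS.∣ X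
  p∤-∣-p^ℤ* {a} {X} e p∤a d = ℤS.∣ᵤ⇒∣ (coprime-∣-p^* e (p∤⇒coprime a p∤a)
    (subst (ℤ.∣ a ∣ ℕD.∣_) (trans (ℤP.abs-* (p^ℤ e) X) (cong (ℕ._* ℤ.∣ X ∣) (∣p^ℤ∣ e))) (ℤS.∣⇒∣ᵤ d)))

  p^∣-p∤*ℕ : ∀ j {f g} → ¬ (p ℕD.∣ f) → p ℕ.^ j ℕD.∣ f ℕ.* g → p ℕ.^ j ℕD.∣ g
  p^∣-p∤*ℕ zero    _ _ = ℕD.1∣ _
  p^∣-p∤*ℕ (suc j) {f} {g} p∤f d with euclidsLemma f g p-prime (ℕD.∣-trans (ℕD.m∣m*n (p ℕ.^ j)) d)
  ... | inj₁ p∣f = ⊥-elim (p∤f p∣f)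
  ... | inj₂ (ℕD.divides g' refl) =
    subst (ℕD._∣ g' ℕ.* p) (ℕP.*-comm (p ℕ.^ j) p)
      (ℕD.*-monoˡ-∣ p (p^∣-p∤*ℕ j {f} {g'} p∤f
        (ℕD.*-cancelʳ-∣ p (subst₂ ℕD._∣_ (ℕP.*-comm p (p ℕ.^ j)) (sym (ℕP.*-assoc f g' p)) d))))

  p^∣-p∤* : ∀ j {f g} → p∤ f → p^ℤ j ℤS.∣ f ℤ.* g → p^ℤ j ℤS.∣ g
  p^∣-p∤* j {f} {g} p∤f d = ℤS.∣ᵤ⇒∣ (subst (ℕD._∣ ℤ.∣ g ∣) (sym (∣p^ℤ∣ j))
    (p^∣-p∤*ℕ j {ℤ.∣ f ∣} {ℤ.∣ g ∣} p∤f (subst₂ ℕD._∣_ (∣p^ℤ∣ j) (ℤP.abs-* f g) (ℤS.∣⇒∣ᵤ d))))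

  unit*p^-injective : ∀ i j {y u} → p∤ y → p∤ u → y ℤ.* p^ℤ i ≡ u ℤ.* p^ℤ j → i ≡ j
  unit*p^-injective zero    zero    _   _   _ = refl
  unit*p^-injective zero    (suc j) {y} {u} p∤y _ e =
    ⊥-elim (p∤y (ℤS.∣⇒∣ᵤ (ℤS.divides (u ℤ.* p^ℤ j) (trans (sym (ℤP.*-identityʳ y)) (trans e (shuffle u j))))))
    where
    shuffle : ∀ u j → u ℤ.* (+ p ℤ.* p^ℤ j) ≡ u ℤ.* p^ℤ j ℤ.* + p
    shuffle u j = ZS.solve 3 (λ u p w → u ZS.:* (p ZS.:* w) ZS.:= (u ZS.:* w) ZS.:* p) refl u (+ p) (p^ℤ j)
  unit*p^-injective (suc i) zero    {y} {u} p∤y p∤u e = sym (unit*p^-injective zero (suc i) {u} {y} p∤u p∤y (sym e))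
  unit*p^-injective (suc i) (suc j) {y} {u} p∤y p∤u e =
    cong suc (unit*p^-injective i j {y} {u} p∤y p∤u (ℤP.*-cancelʳ-≡ (y ℤ.* p^ℤ i) (u ℤ.* p^ℤ j) (+ p) {{ℤ.≢-nonZero (λ e → p≢0 (ℤP.+-injective e))}}
      (trans (shuffle y i) (trans e (sym (shuffle u j))))))
    where
    shuffle : ∀ u j → u ℤ.* p^ℤ j ℤ.* + p ≡ u ℤ.* (+ p ℤ.* p^ℤ j)
    shuffle u j = ZS.solve 3 (λ u p w → (u ZS.:* w) ZS.:* p ZS.:= u ZS.:* (p ZS.:* w)) refl u (+ p) (p^ℤ j)

  PowEq-unique : ∀ {x y y'} k → PowEq p x (ι y) k → PowEq p x (ι y') k → y ≡ y'
  PowEq-unique (+ n)    e₁ e₂ = ι-injective (*-cancelʳ-≢0 (p^≢0 n) (trans (sym e₁) e₂))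
  PowEq-unique -[1+ n ] e₁ e₂ = ι-injective (trans (sym e₁) e₂)

  Tilde-unit : ∀ {x y e u} → Tilde p x y → p∤ u → x ℚ.* p^ e ≡ ι u → y ≡ u
  Tilde-unit {x} {y} {e} {u} (+ n , (u' , p∤u' , x≡u'p^n) , x≡yp^n) p∤u h =
    trans (sym (ℤP.*-identityʳ y)) (trans (cong (λ i → y ℤ.* p^ℤ i) (sym n+e≡0)) (trans y≡u (ℤP.*-identityʳ u)))
    where
    p∤y : p∤ y
    p∤y = subst p∤_ (sym (PowEq-unique {x} {y} {u'} (+ n) x≡yp^n x≡u'p^n)) p∤u'
    y≡u : y ℤ.* p^ℤ (n ℕ.+ e) ≡ u ℤ.* p^ℤ 0
    y≡u = trans (ι-injective (begin
       ι (y ℤ.* p^ℤ (n ℕ.+ e))    ≡⟨ sym (ι*p^ y (n ℕ.+ e)) ⟩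
       ι y ℚ.* p^ (n ℕ.+ e)       ≡⟨ trans (cong (ι y ℚ.*_) (p^-+ n e)) (sym (ℚP.*-assoc (ι y) (p^ n) (p^ e))) ⟩
       ι y ℚ.* p^ n ℚ.* p^ e      ≡⟨ cong (ℚ._* p^ e) (sym x≡yp^n) ⟩
       x ℚ.* p^ e                 ≡⟨ h ⟩
       ι u                        ∎)) (sym (ℤP.*-identityʳ u))
      where open ≡-Reasoning
    n+e≡0 : n ℕ.+ e ≡ 0
    n+e≡0 = unit*p^-injective (n ℕ.+ e) 0 {y} {u} p∤y p∤u y≡u
  Tilde-unit {x} {y} {e} {u} (-[1+ n ] , (u' , p∤u' , x≡u'p^-n) , x≡yp^-n) p∤u h =
    ℤP.*-cancelʳ-≡ y u (p^ℤ e) {{ℤ.≢-nonZero (p^ℤ≢0 e)}} (trans y≡u (cong (λ i → u ℤ.* p^ℤ i) (sym e≡n+1)))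
    where
    p∤y : p∤ y
    p∤y = subst p∤_ (sym (PowEq-unique {x} {y} {u'} -[1+ n ] x≡yp^-n x≡u'p^-n)) p∤u'
    y≡u : y ℤ.* p^ℤ e ≡ u ℤ.* p^ℤ (suc n)
    y≡u = ι-injective (begin
       ι (y ℤ.* p^ℤ e)               ≡⟨ sym (ι*p^ y e) ⟩
       ι y ℚ.* p^ e                  ≡⟨ cong (ℚ._* p^ e) (sym x≡yp^-n) ⟩
       x ℚ.* p^ (suc n) ℚ.* p^ e     ≡⟨ solve 3 (λ x a b → x :* a :* b := x :* b :* a) refl x (p^ (suc n)) (p^ e) ⟩
       x ℚ.* p^ e ℚ.* p^ (suc n)     ≡⟨ cong (ℚ._* p^ (suc n)) h ⟩
       ι u ℚ.* p^ (suc n)            ≡⟨ ι*p^ u (suc n) ⟩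
       ι (u ℤ.* p^ℤ (suc n))         ∎)
      where open ≡-Reasoning
    e≡n+1 : e ≡ suc n
    e≡n+1 = unit*p^-injective e (suc n) {y} {u} p∤y p∤u y≡u

  ≡-mod⇒∣∸ : ∀ M .{{_ : ℕ.NonZero M}} a b → a % M ≡ b % M → M ℕD.∣ b ℕ.∸ a
  ≡-mod⇒∣∸ M a b e = ℕD.divides (b / M ℕ.∸ a / M) (begin
    b ℕ.∸ a                                                   ≡⟨ cong₂ ℕ._∸_ (m≡m%n+[m/n]*n b M) (m≡m%n+[m/n]*n a M) ⟩
    (b % M ℕ.+ (b / M) ℕ.* M) ℕ.∸ (a % M ℕ.+ (a / M) ℕ.* M)   ≡⟨ cong (λ z → (b % M ℕ.+ (b / M) ℕ.* M) ℕ.∸ (z ℕ.+ (a / M) ℕ.* M)) e ⟩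
    (b % M ℕ.+ (b / M) ℕ.* M) ℕ.∸ (b % M ℕ.+ (a / M) ℕ.* M)   ≡⟨ ℕP.[m+n]∸[m+o]≡n∸o (b % M) _ _ ⟩
    (b / M) ℕ.* M ℕ.∸ (a / M) ℕ.* M                           ≡⟨ sym (ℕP.*-distribʳ-∸ M (b / M) (a / M)) ⟩
    (b / M ℕ.∸ a / M) ℕ.* M                                   ∎)
    where open ≡-Reasoning

  -- Two of p⁰, …, p^M agree modulo M (pigeonhole); cancel the smaller power.
  p^-order : ∀ m → p∤ m → ∃ λ o → 1 ≤ o × m ℤS.∣ (p^ℤ o ℤ.- + 1)
  p^-order m p∤m = d , 1≤d , ℤS.∣ᵤ⇒∣ (subst (M ℕD.∣_) (cong ℤ.∣_∣ (sym p^ℤd-1≡)) M∣p^d∸1)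
    where
    M : ℕ
    M = ℤ.∣ m ∣
    instance
      M-nonZero : ℕ.NonZero M
      M-nonZero = ℕ.≢-nonZero λ e → p∤⇒≢0 {m} p∤m (ℤP.∣i∣≡0⇒i≡0 e)
    residue : Fin (suc M) → Fin M
    residue i = fromℕ< (m%n<n (p ℕ.^ toℕ i) M)
    collision : Σ (Fin (suc M)) λ i → Σ (Fin (suc M)) λ j → toℕ i < toℕ j × residue i ≡ residue j
    collision = FinP.pigeonhole (ℕP.n<1+n M) residue
    i j : ℕ
    i = toℕ (proj₁ collision)
    j = toℕ (proj₁ (proj₂ collision))
    i<j : i < j
    i<j = proj₁ (proj₂ (proj₂ collision))
    same-residue : p ℕ.^ i % M ≡ p ℕ.^ j % M
    same-residue = trans (sym (FinP.toℕ-fromℕ< (m%n<n (p ℕ.^ i) M)))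
      (trans (cong toℕ (proj₂ (proj₂ (proj₂ collision)))) (FinP.toℕ-fromℕ< (m%n<n (p ℕ.^ j) M)))
    d : ℕ
    d = j ℕ.∸ i
    1≤d : 1 ≤ d
    1≤d = ℕP.m<n⇒0<n∸m i<j
    p^j∸p^i≡ : p ℕ.^ j ℕ.∸ p ℕ.^ i ≡ p ℕ.^ i ℕ.* (p ℕ.^ d ℕ.∸ 1)
    p^j∸p^i≡ = trans (cong₂ ℕ._∸_ (trans (cong (p ℕ.^_) (sym (ℕP.m+[n∸m]≡n (ℕP.<⇒≤ i<j)))) (ℕP.^-distribˡ-+-* p i d))
                                  (sym (ℕP.*-identityʳ (p ℕ.^ i))))
                     (sym (ℕP.*-distribˡ-∸ (p ℕ.^ i) (p ℕ.^ d) 1))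
    M∣p^d∸1 : M ℕD.∣ p ℕ.^ d ℕ.∸ 1
    M∣p^d∸1 = coprime-∣-p^* i (p∤⇒coprime m p∤m)
                (subst (M ℕD.∣_) p^j∸p^i≡ (≡-mod⇒∣∸ M (p ℕ.^ i) (p ℕ.^ j) same-residue))
    p^ℤd-1≡ : p^ℤ d ℤ.- + 1 ≡ + (p ℕ.^ d ℕ.∸ 1)
    p^ℤd-1≡ = trans (cong (ℤ._- + 1) (p^ℤ≡+ d)) (trans (ℤP.m-n≡m⊖n (p ℕ.^ d) 1) (ℤP.⊖-≥ (ℕP.m^n>0 p d)))

  p^o-1∣p^lo-1 : ∀ o l → (p^ℤ o ℤ.- + 1) ℤS.∣ (p^ℤ (l ℕ.* o) ℤ.- + 1)
  p^o-1∣p^lo-1 o zero    = ℤS.divides (+ 0) refl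
  p^o-1∣p^lo-1 o (suc l) = subst ((p^ℤ o ℤ.- + 1) ℤS.∣_) (sym split)
    (ℤS.∣m∣n⇒∣m+n {p^ℤ o ℤ.- + 1} {p^ℤ o ℤ.* (p^ℤ (l ℕ.* o) ℤ.- + 1)} {p^ℤ o ℤ.- + 1}
      (ℤS.∣n⇒∣m*n (p^ℤ o) (p^o-1∣p^lo-1 o l)) (ℤS.∣-refl {p^ℤ o ℤ.- + 1}))
    where
    split : p^ℤ (suc l ℕ.* o) ℤ.- + 1 ≡ p^ℤ o ℤ.* (p^ℤ (l ℕ.* o) ℤ.- + 1) ℤ.+ (p^ℤ o ℤ.- + 1)
    split = trans (cong (ℤ._- + 1) (ℤP.^-distribˡ-+-* (+ p) o (l ℕ.* o)))
      (ZS.solve 2 (λ a b → a ZS.:* b ZS.:- ZS.con (+ 1) ZS.:= a ZS.:* (b ZS.:- ZS.con (+ 1)) ZS.:+ (a ZS.:- ZS.con (+ 1))) refl (p^ℤ o) (p^ℤ (l ℕ.* o)))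

  ∣q-p^-periodic : ∀ {M q} j₀ o l → M ℤS.∣ (q ℤ.- p^ℤ j₀) → M ℤS.∣ (p^ℤ o ℤ.- + 1) →
                   M ℤS.∣ (q ℤ.- p^ℤ (j₀ ℕ.+ l ℕ.* o))
  ∣q-p^-periodic {M} {q} j₀ o l M∣q-p^j₀ M∣p^o-1 = subst (M ℤS.∣_) (sym split)
    (ℤS.∣m∣n⇒∣m-n {M} {q ℤ.- p^ℤ j₀} {p^ℤ j₀ ℤ.* (p^ℤ (l ℕ.* o) ℤ.- + 1)} M∣q-p^j₀
      (ℤS.∣n⇒∣m*n (p^ℤ j₀) (ℤS.∣-trans M∣p^o-1 (p^o-1∣p^lo-1 o l))))
    where
    split : q ℤ.- p^ℤ (j₀ ℕ.+ l ℕ.* o) ≡ (q ℤ.- p^ℤ j₀) ℤ.- p^ℤ j₀ ℤ.* (p^ℤ (l ℕ.* o) ℤ.- + 1)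
    split = trans (cong (λ z → q ℤ.- z) (ℤP.^-distribˡ-+-* (+ p) j₀ (l ℕ.* o)))
      (ZS.solve 3 (λ q a b → q ZS.:- a ZS.:* b ZS.:= (q ZS.:- a) ZS.:- a ZS.:* (b ZS.:- ZS.con (+ 1))) refl q (p^ℤ j₀) (p^ℤ (l ℕ.* o)))

  -- If f g = −r p^j with p ∤ f, then p^j ∣ g, which forces |g| ≥ p^j; so |g| cannot be small.
  small-factorisation-impossible : ∀ {f g r j} K → p∤ f → r ≢ + 0 → f ℤ.* g ≡ ℤ.- r ℤ.* p^ℤ j →
    ℤ.∣ g ∣ ≤ ℤ.∣ f ∣ ℕ.+ K → ℤ.∣ r ∣ ℕ.+ K < p ℕ.^ j → ⊥
  small-factorisation-impossible {f} {g} {r} {j} K p∤f r≢0 fg≡ g≤f+K bound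
    with p^∣-p∤* j {f} {g} p∤f (ℤS.divides (ℤ.- r) fg≡)
  ... | ℤS.divides h g≡hp^j = ℕP.<-irrefl refl (ℕP.<-≤-trans bound (begin
    p ℕ.^ j             ≤⟨ p^j≤g ⟩
    ℤ.∣ g ∣             ≤⟨ g≤f+K ⟩
    ℤ.∣ f ∣ ℕ.+ K       ≤⟨ ℕP.+-monoˡ-≤ K f≤r ⟩
    ℤ.∣ r ∣ ℕ.+ K       ∎))
    where
    open ℕP.≤-Reasoning
    fh≡-r : f ℤ.* h ≡ ℤ.- r
    fh≡-r = ℤP.*-cancelʳ-≡ _ _ (p^ℤ j) {{ℤ.≢-nonZero (p^ℤ≢0 j)}}
      (trans (ℤP.*-assoc f h (p^ℤ j)) (trans (cong (f ℤ.*_) (sym g≡hp^j)) fg≡))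
    instance
      ∣h∣-nonZero : ℕ.NonZero ℤ.∣ h ∣
      ∣h∣-nonZero = ℕ.≢-nonZero λ ∣h∣≡0 → r≢0 (
        trans (sym (ℤP.neg-involutive r)) (trans (cong ℤ.-_ (sym fh≡-r))
          (trans (cong (λ h → ℤ.- (f ℤ.* h)) (ℤP.∣i∣≡0⇒i≡0 ∣h∣≡0)) (cong ℤ.-_ (ℤP.*-zeroʳ f)))))
    f≤r : ℤ.∣ f ∣ ≤ ℤ.∣ r ∣
    f≤r = ℕP.≤-trans (ℕP.m≤m*n ℤ.∣ f ∣ ℤ.∣ h ∣)
            (ℕP.≤-reflexive (trans (sym (ℤP.abs-* f h)) (trans (cong ℤ.∣_∣ fh≡-r) (ℤP.∣-i∣≡∣i∣ r))))
    p^j≤g : p ℕ.^ j ≤ ℤ.∣ g ∣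
    p^j≤g = ℕP.≤-trans (ℕP.m≤n*m (p ℕ.^ j) ℤ.∣ h ∣)
              (ℕP.≤-reflexive (trans (cong (ℤ.∣ h ∣ ℕ.*_) (sym (∣p^ℤ∣ j)))
                (trans (sym (ℤP.abs-* h (p^ℤ j))) (cong ℤ.∣_∣ (sym g≡hp^j)))))

  -- X² = b² − r p^j factors as (X − b)(X + b) = −r p^j; since p ∤ 2b, p divides at most one factor.
  not-square : ∀ {b r j} X → p∤ b → r ≢ + 0 → ℤ.∣ r ∣ ℕ.+ 2 ℕ.* ℤ.∣ b ∣ < p ℕ.^ j →
               X ℤ.* X ≢ b ℤ.* b ℤ.- r ℤ.* p^ℤ j
  not-square {b} {r} {j} X p∤b r≢0 bound X²≡ = cases (ℕD._∣?_ p ℤ.∣ X ℤ.- b ∣) (ℕD._∣?_ p ℤ.∣ X ℤ.+ b ∣)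
    where
    X²-b²≡ : X ℤ.* X ℤ.- b ℤ.* b ≡ ℤ.- r ℤ.* p^ℤ j
    X²-b²≡ = trans (cong (ℤ._- b ℤ.* b) X²≡)
      (ZS.solve 3 (λ b r w → b ZS.:* b ZS.:- r ZS.:* w ZS.:- b ZS.:* b ZS.:= ZS.:- r ZS.:* w) refl b r (p^ℤ j))
    ∣shift∣≤ : ∀ y c {z} → z ≡ y ℤ.+ c ℤ.* b → ℤ.∣ c ∣ ≡ 2 → ℤ.∣ z ∣ ≤ ℤ.∣ y ∣ ℕ.+ 2 ℕ.* ℤ.∣ b ∣
    ∣shift∣≤ y c refl ∣c∣≡2 = ℕP.≤-trans (ℤP.∣i+j∣≤∣i∣+∣j∣ y (c ℤ.* b))
      (ℕP.≤-reflexive (cong (ℤ.∣ y ∣ ℕ.+_) (trans (ℤP.abs-* c b) (cong (ℕ._* ℤ.∣ b ∣) ∣c∣≡2))))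
    cases : Dec (p ℕD.∣ ℤ.∣ X ℤ.- b ∣) → Dec (p ℕD.∣ ℤ.∣ X ℤ.+ b ∣) → ⊥
    cases (no p∤X-b) _ = small-factorisation-impossible {X ℤ.- b} {X ℤ.+ b} {r} {j} (2 ℕ.* ℤ.∣ b ∣) p∤X-b r≢0
      (trans (ZS.solve 2 (λ X b → (X ZS.:- b) ZS.:* (X ZS.:+ b) ZS.:= X ZS.:* X ZS.:- b ZS.:* b) refl X b) X²-b²≡)
      (∣shift∣≤ (X ℤ.- b) (+ 2) (ZS.solve 2 (λ X b → X ZS.:+ b ZS.:= (X ZS.:- b) ZS.:+ ZS.con (+ 2) ZS.:* b) refl X b) refl)
      bound
    cases (yes _) (no p∤X+b) = small-factorisation-impossible {X ℤ.+ b} {X ℤ.- b} {r} {j} (2 ℕ.* ℤ.∣ b ∣) p∤X+b r≢0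
      (trans (ZS.solve 2 (λ X b → (X ZS.:+ b) ZS.:* (X ZS.:- b) ZS.:= X ZS.:* X ZS.:- b ZS.:* b) refl X b) X²-b²≡)
      (∣shift∣≤ (X ℤ.+ b) -[1+ 1 ] (ZS.solve 2 (λ X b → X ZS.:- b ZS.:= (X ZS.:+ b) ZS.:+ ZS.con -[1+ 1 ] ZS.:* b) refl X b) refl)
      bound
    cases (yes p∣X-b) (yes p∣X+b) = p∤-* {+ 2} {b} p∤2 p∤b (ℤS.∣⇒∣ᵤ (subst (+ p ℤS.∣_)
      (ZS.solve 2 (λ X b → (X ZS.:+ b) ZS.:- (X ZS.:- b) ZS.:= ZS.con (+ 2) ZS.:* b) refl X b)
      (ℤS.∣m∣n⇒∣m-n {+ p} {X ℤ.+ b} {X ℤ.- b} (ℤS.∣ᵤ⇒∣ {+ p} {X ℤ.+ b} p∣X+b) (ℤS.∣ᵤ⇒∣ {+ p} {X ℤ.- b} p∣X-b))))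

  denominatorSum : List ℚ → ℕ
  denominatorSum []      = 0
  denominatorSum (l ∷ L) = ℚ.↧ₙ l ℕ.+ denominatorSum L

  -- An element of L has denominator at most the sum of all denominators of L.
  ∉-large-denominator : ∀ {x y J} (L : List ℚ) → p∤ y → x ℚ.* p^ J ≡ ι y →
                        denominatorSum L < p ℕ.^ J → x ∉ L
  ∉-large-denominator {x} {y} {J} (l ∷ L) p∤y h bound (here refl) =
    ℕP.<-irrefl refl (ℕP.<-≤-trans (ℕP.≤-<-trans (ℕP.m≤m+n (ℚ.↧ₙ x) (denominatorSum L)) bound) p^J≤den)
    where
    D : ℕ
    D = ℚ.↧ₙ x
    yD≡ : y ℤ.* + D ≡ ℚ.↥ x ℤ.* p^ℤ J
    yD≡ = ι-injective (begin
      ι (y ℤ.* + D)            ≡⟨ ι-homo-* y (+ D) ⟩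
      ι y ℚ.* ι (+ D)          ≡⟨ cong (ℚ._* ι (+ D)) (sym h) ⟩
      x ℚ.* p^ J ℚ.* ι (+ D)   ≡⟨ solve 3 (λ a b c → a :* b :* c := a :* c :* b) refl x (p^ J) (ι (+ D)) ⟩
      x ℚ.* ι (+ D) ℚ.* p^ J   ≡⟨ cong (ℚ._* p^ J) (ι-↧ x) ⟩
      ι (ℚ.↥ x) ℚ.* p^ J       ≡⟨ ι*p^ (ℚ.↥ x) J ⟩
      ι (ℚ.↥ x ℤ.* p^ℤ J)      ∎)
      where open ≡-Reasoning
    p^J≤den : p ℕ.^ J ≤ D
    p^J≤den = subst (_≤ D) (∣p^ℤ∣ J)
      (ℕD.∣⇒≤ (ℤS.∣⇒∣ᵤ (p^∣-p∤* J {y} {+ D} p∤y (ℤS.divides (ℚ.↥ x) yD≡))))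
  ∉-large-denominator {x} {y} {J} (l ∷ L) p∤y h bound (there x∈L) =
    ∉-large-denominator {x} {y} {J} L p∤y h (ℕP.≤-<-trans (ℕP.m≤n+m (denominatorSum L) (ℚ.↧ₙ l)) bound) x∈L

  ∣∣<⇒bounds : ∀ z m → ℤ.∣ z ∣ < m → (ℤ.- (+ m) ℤ.< z) × (z ℤ.< + m)
  ∣∣<⇒bounds (+ n)    (suc m) lt         = ℤ.-<+ , ℤ.+<+ lt
  ∣∣<⇒bounds -[1+ n ] (suc m) (ℕ.s≤s lt) = ℤ.-<- lt , ℤ.-<+

  within-p : ∀ {w z} J → w ℚ.* p^ J ≡ ι z → ℤ.∣ z ∣ < p ℕ.* p ℕ.^ J → (ℚ.- pℚ p ℚ.< w) × (w ℚ.< pℚ p)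
  within-p {w} {z} J h ∣z∣< with ∣∣<⇒bounds z (p ℕ.* p ℕ.^ J) ∣z∣<
  ... | lower , upper =
    ℚP.*-cancelʳ-<-nonNeg (p^ J) {{p^J≥0}} (subst₂ ℚ._<_ (sym -p·p^J≡) (sym h) (ι-mono-< lower)) ,
    ℚP.*-cancelʳ-<-nonNeg (p^ J) {{p^J≥0}} (subst₂ ℚ._<_ (sym h) (sym p·p^J≡) (ι-mono-< upper))
    where
    p^J≥0 : ℚ.NonNegative (p^ J)
    p^J≥0 = ℚP.pos⇒nonNeg (p^ J) {{p^-positive J}}
    p·p^J≡ : pℚ p ℚ.* p^ J ≡ ι (+ (p ℕ.* p ℕ.^ J))
    p·p^J≡ = trans (ι*p^ (+ p) J) (cong ι (trans (cong ((+ p) ℤ.*_) (p^ℤ≡+ J)) (sym (ℤP.pos-* p (p ℕ.^ J)))))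
    -p·p^J≡ : ℚ.- pℚ p ℚ.* p^ J ≡ ι (ℤ.- (+ (p ℕ.* p ℕ.^ J)))
    -p·p^J≡ = trans (sym (ℚP.neg-distribˡ-* (pℚ p) (p^ J))) (trans (cong ℚ.-_ p·p^J≡) (sym (ι-homo‿- (+ (p ℕ.* p ℕ.^ J)))))

  module Construction
    (u : ℕ) (a : ℕ → ℚ) (bcf : IsFiniteBCF p (suc u) a)
    (a₀-large : PAbsGt1 p (a 0))
    (nice-b : ι (+ 4) ℚ.* ℚ.∣ Aprev a u ∣ ℚ.< pℚ p ℚ.* ℚ.∣ Aₙ a u ∣)
    {Ã B̃ q : ℤ} {j₀ : ℕ} (Ã-tilde : Tilde p (Aₙ a u) Ã) (B̃-tilde : Tilde p (Bₙ a u) B̃)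
    (B̃∣q : B̃ ℤD.∣ q) (q∣B̃² : q ℤD.∣ (B̃ ℤ.* B̃)) (Ã²∣q-p^j₀ : (Ã ℤ.* Ã) ℤD.∣ (q ℤ.- p^ℤ j₀))
    (k₀ : ℕ) (v-a₀ : Vp p (a 0) (ℤ.- (+ k₀))) where

    1≤k₀×a₀-den : 1 ≤ k₀ × Den≡ k₀ (a 0)
    1≤k₀×a₀-den = Vp-neg⇒Den≡ k₀ a₀-large v-a₀

    1≤k₀ : 1 ≤ k₀
    1≤k₀ = proj₁ 1≤k₀×a₀-den

    a₀-den : Den≡ k₀ (a 0)
    a₀-den = proj₂ 1≤k₀×a₀-den

    a-large : ∀ i → 1 ≤ i → i ≤ u → Σ ℕ λ k → 1 ≤ k × Den≡ k (a i)
    a-large i 1≤i i≤u = exact-denominator (proj₁ (proj₁ bcf i (ℕ.s≤s i≤u))) (proj₂ bcf i 1≤i (ℕ.s≤s i≤u))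

    -- Every periodic continuation of a agrees with it up to index u; the choice x = 2a₀ is arbitrary.
    module Reference = PeriodicConvergence a (ι (+ 2) ℚ.* a 0) u a-large (k₀ , 1≤k₀ , Den≡-2* a₀-den) 1≤k₀ a₀-den

    agrees-with-a : ∀ i → i ≤ u → Reference.s i ≡ a i
    agrees-with-a zero    _   = refl
    agrees-with-a (suc k) k<u = Reference.s-head k k<u

    A A' B B' : ℚ
    A  = Aₙ a u
    A' = Aprev a u
    B  = Bₙ a u
    B' = Bprev a u

    eA eB : ℕ
    eA = Reference.denExp k₀ u
    eB = Reference.denExp 0 u

    eA≡k₀+eB : eA ≡ k₀ ℕ.+ eB
    eA≡k₀+eB = Reference.denExp-shift k₀ u

    private
      same : (Aₙ Reference.s u ≡ A) × (Aprev Reference.s u ≡ A') × (Bₙ Reference.s u ≡ B) × (Bprev Reference.s u ≡ B')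
      same = convergents-agree Reference.s a u agrees-with-a
      A-dens : Den≡ eA (Aₙ Reference.s u) × Den≤ eA (Aprev Reference.s u)
      A-dens = Reference.A-denominators a₀-den u
      B-dens : Den≡ eB (Bₙ Reference.s u) × Den≤ eB (Bprev Reference.s u)
      B-dens = Reference.B-denominators u

    A-den : Den≡ eA A
    A-den = subst (Den≡ eA) (proj₁ same) (proj₁ A-dens)

    A'-den : Den≤ eA A'
    A'-den = subst (Den≤ eA) (proj₁ (proj₂ same)) (proj₂ A-dens)

    B-den : Den≡ eB B
    B-den = subst (Den≡ eB) (proj₁ (proj₂ (proj₂ same))) (proj₁ B-dens)

    B'-den : Den≤ eB B'
    B'-den = subst (Den≤ eB) (proj₂ (proj₂ (proj₂ same))) (proj₂ B-dens)

    open Den≡ A-den  using () renaming (unit to uA; p∤unit to p∤uA; unit-eq to A≡)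
    open Den≤ A'-den using () renaming (num to wA; num-eq to A'≡)
    open Den≡ B-den  using () renaming (unit to uB; p∤unit to p∤uB; unit-eq to B≡)
    open Den≤ B'-den using () renaming (num to wB; num-eq to B'≡)

    δ : ℤ
    δ with convDet-±1 a u
    ... | inj₁ _ = + 1
    ... | inj₂ _ = ℤ.- (+ 1)

    ιδ≡ : ι δ ≡ convDet a u
    ιδ≡ with convDet-±1 a u
    ... | inj₁ e = sym e
    ... | inj₂ e = trans (ι-homo‿- (+ 1)) (sym e)

    δ²≡1 : δ ℤ.* δ ≡ + 1
    δ²≡1 with convDet-±1 a u
    ... | inj₁ _ = refl
    ... | inj₂ _ = refl

    det-integral : uA ℤ.* wB ℤ.- wA ℤ.* uB ≡ δ ℤ.* p^ℤ (eA ℕ.+ eB)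
    det-integral = ι-injective (begin
      ι (uA ℤ.* wB ℤ.- wA ℤ.* uB)            ≡⟨ trans (ι-homo-sub (uA ℤ.* wB) (wA ℤ.* uB)) (cong₂ ℚ._-_ (ι-homo-* uA wB) (ι-homo-* wA uB)) ⟩
      ι uA ℚ.* ι wB ℚ.- ι wA ℚ.* ι uB        ≡⟨ cong₂ (λ x y → x ℚ.* ι wB ℚ.- y ℚ.* ι uB) (sym A≡) (sym A'≡) ⟩
      (A ℚ.* p^ eA) ℚ.* ι wB ℚ.- (A' ℚ.* p^ eA) ℚ.* ι uB
                                             ≡⟨ cong₂ (λ x y → (A ℚ.* p^ eA) ℚ.* x ℚ.- (A' ℚ.* p^ eA) ℚ.* y) (sym B'≡) (sym B≡) ⟩
      (A ℚ.* p^ eA) ℚ.* (B' ℚ.* p^ eB) ℚ.- (A' ℚ.* p^ eA) ℚ.* (B ℚ.* p^ eB)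
                                             ≡⟨ solve 6 (λ A A' B B' x y → (A :* x) :* (B' :* y) :- (A' :* x) :* (B :* y) := (A :* B' :- A' :* B) :* (x :* y))
                                                  refl A A' B B' (p^ eA) (p^ eB) ⟩
      convDet a u ℚ.* (p^ eA ℚ.* p^ eB)      ≡⟨ cong₂ ℚ._*_ (sym ιδ≡) (sym (p^-+ eA eB)) ⟩
      ι δ ℚ.* p^ (eA ℕ.+ eB)                 ≡⟨ ι*p^ δ (eA ℕ.+ eB) ⟩
      ι (δ ℤ.* p^ℤ (eA ℕ.+ eB))              ∎)
      where open ≡-Reasoning

    Ã≡uA : Ã ≡ uA
    Ã≡uA = Tilde-unit {A} {Ã} {eA} {uA} Ã-tilde p∤uA A≡

    B̃≡uB : B̃ ≡ uB
    B̃≡uB = Tilde-unit {B} {B̃} {eB} {uB} B̃-tilde p∤uB B≡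

    private
      uB∣q : uB ℤS.∣ q
      uB∣q = subst (ℤS._∣ q) B̃≡uB (ℤS.∣ᵤ⇒∣ {B̃} {q} B̃∣q)
      q∣uB² : q ℤS.∣ uB ℤ.* uB
      q∣uB² = subst (λ b → q ℤS.∣ b ℤ.* b) B̃≡uB (ℤS.∣ᵤ⇒∣ {q} {B̃ ℤ.* B̃} q∣B̃²)

    uA²∣q-p^j₀ : (uA ℤ.* uA) ℤS.∣ (q ℤ.- p^ℤ j₀)
    uA²∣q-p^j₀ = subst (λ z → (z ℤ.* z) ℤS.∣ (q ℤ.- p^ℤ j₀)) Ã≡uA (ℤS.∣ᵤ⇒∣ {Ã ℤ.* Ã} {q ℤ.- p^ℤ j₀} Ã²∣q-p^j₀)

    q' r : ℤ
    q' = ℤS._∣_.quotient uB∣q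
    r  = ℤS._∣_.quotient q∣uB²

    q≡q'uB : q ≡ q' ℤ.* uB
    q≡q'uB = ℤS._∣_.equality uB∣q

    uB²≡rq : uB ℤ.* uB ≡ r ℤ.* q
    uB²≡rq = ℤS._∣_.equality q∣uB²

    rq'≡uB : r ℤ.* q' ≡ uB
    rq'≡uB = ℤP.*-cancelʳ-≡ (r ℤ.* q') uB uB {{ℤ.≢-nonZero (p∤⇒≢0 {uB} p∤uB)}}
      (trans (ℤP.*-assoc r q' uB) (trans (cong (r ℤ.*_) (sym q≡q'uB)) (sym uB²≡rq)))

    r≢0 : r ≢ + 0
    r≢0 r≡0 = p∤⇒≢0 {uB} p∤uB (trans (sym rq'≡uB) (cong (ℤ._* q') r≡0))

    p∤q : p∤ q
    p∤q p∣q = p∤-* {uB} {uB} p∤uB p∤uB (subst (+ p ℤD.∣_) (sym uB²≡rq) (p∣-* r p∣q))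

    p∤q' : p∤ q'
    p∤q' p∣q' = p∤q (subst (+ p ℤD.∣_) (trans (ℤP.*-comm uB q') (sym q≡q'uB)) (p∣-* uB p∣q'))

    p∤δ : p∤ δ
    p∤δ p∣δ = p∤1 (subst (+ p ℤD.∣_) δ²≡1 (p∣-* δ p∣δ))

    o : ℕ
    o = proj₁ (p^-order (uA ℤ.* uA) (p∤-* {uA} {uA} p∤uA p∤uA))

    1≤o : 1 ≤ o
    1≤o = proj₁ (proj₂ (p^-order (uA ℤ.* uA) (p∤-* {uA} {uA} p∤uA p∤uA)))

    uA²∣p^o-1 : (uA ℤ.* uA) ℤS.∣ (p^ℤ o ℤ.- + 1)
    uA²∣p^o-1 = proj₂ (proj₂ (p^-order (uA ℤ.* uA) (p∤-* {uA} {uA} p∤uA p∤uA)))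

    4wA<p·uA : 4 ℕ.* ℤ.∣ wA ∣ < p ℕ.* ℤ.∣ uA ∣
    4wA<p·uA = ℤP.drop‿+<+ (subst₂ ℤ._<_ (sym (ℤP.pos-* 4 ℤ.∣ wA ∣)) (sym (ℤP.pos-* p ℤ.∣ uA ∣))
                 (ι-cancel-< (subst₂ ℚ._<_ (scaled (+ 4) A' wA A'≡) (scaled (+ p) A uA A≡) nice-b·p^eA)))
      where
      nice-b·p^eA : ι (+ 4) ℚ.* ℚ.∣ A' ∣ ℚ.* p^ eA ℚ.< pℚ p ℚ.* ℚ.∣ A ∣ ℚ.* p^ eA
      nice-b·p^eA = ℚP.*-monoˡ-<-pos (p^ eA) {{p^-positive eA}} nice-b
      scaled : ∀ c y w → y ℚ.* p^ eA ≡ ι w → ι c ℚ.* ℚ.∣ y ∣ ℚ.* p^ eA ≡ ι (c ℤ.* + ℤ.∣ w ∣)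
      scaled c y w h = begin
        ι c ℚ.* ℚ.∣ y ∣ ℚ.* p^ eA          ≡⟨ ℚP.*-assoc (ι c) ℚ.∣ y ∣ (p^ eA) ⟩
        ι c ℚ.* (ℚ.∣ y ∣ ℚ.* p^ eA)        ≡⟨ cong (λ z → ι c ℚ.* (ℚ.∣ y ∣ ℚ.* z)) (sym (∣p^∣ eA)) ⟩
        ι c ℚ.* (ℚ.∣ y ∣ ℚ.* ℚ.∣ p^ eA ∣)  ≡⟨ cong (ι c ℚ.*_) (sym (ℚP.∣p*q∣≡∣p∣*∣q∣ y (p^ eA))) ⟩
        ι c ℚ.* ℚ.∣ y ℚ.* p^ eA ∣          ≡⟨ cong (λ z → ι c ℚ.* ℚ.∣ z ∣) h ⟩
        ι c ℚ.* ℚ.∣ ι w ∣                  ≡⟨ cong (ι c ℚ.*_) (∣ι∣ w) ⟩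
        ι c ℚ.* ι (+ ℤ.∣ w ∣)              ≡⟨ sym (ι-homo-* c (+ ℤ.∣ w ∣)) ⟩
        ι (c ℤ.* + ℤ.∣ w ∣)                ∎
        where open ≡-Reasoning

    ∣δ∣≡1 : ℤ.∣ δ ∣ ≡ 1
    ∣δ∣≡1 = ℕP.m*n≡1⇒m≡1 ℤ.∣ δ ∣ ℤ.∣ δ ∣ (trans (sym (ℤP.abs-* δ δ)) (cong ℤ.∣_∣ δ²≡1))

    module Choice (Lb : ℕ) (1≤Lb : 1 ≤ Lb) where

      E j J : ℕ
      E = eA ℕ.+ eB
      j = j₀ ℕ.+ (Lb ℕ.+ E) ℕ.* o
      J = j ℕ.∸ E

      Lb+E≤j : Lb ℕ.+ E ≤ j
      Lb+E≤j = ℕP.≤-trans (ℕP.m≤m*n (Lb ℕ.+ E) o {{ℕ.≢-nonZero (λ o≡0 → ℕP.<⇒≢ 1≤o (sym o≡0))}})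
                          (ℕP.m≤n+m ((Lb ℕ.+ E) ℕ.* o) j₀)

      E+J≡j : E ℕ.+ J ≡ j
      E+J≡j = ℕP.m+[n∸m]≡n (ℕP.≤-trans (ℕP.m≤n+m E Lb) Lb+E≤j)

      Lb≤J : Lb ≤ J
      Lb≤J = subst (_≤ J) (ℕP.m+n∸n≡m Lb E) (ℕP.∸-monoˡ-≤ E Lb+E≤j)

      1≤J : 1 ≤ J
      1≤J = ℕP.≤-trans 1≤Lb Lb≤J

      private
        uA²∣q-p^j : (uA ℤ.* uA) ℤS.∣ (q ℤ.- p^ℤ j)
        uA²∣q-p^j = ∣q-p^-periodic {uA ℤ.* uA} {q} j₀ o (Lb ℕ.+ E) uA²∣q-p^j₀ uA²∣p^o-1

      ℓ m : ℤ
      ℓ = ℤS._∣_.quotient uA²∣q-p^j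
      m = r ℤ.* ℓ

      q-p^j≡ : q ℤ.- p^ℤ j ≡ ℓ ℤ.* (uA ℤ.* uA)
      q-p^j≡ = ℤS._∣_.equality uA²∣q-p^j

      X K : ℤ
      X = δ ℤ.* q' ℤ.+ wA ℤ.* p^ℤ J
      K = δ ℤ.* ℓ ℤ.* uA ℤ.+ wB ℤ.* p^ℤ J

      uB·X≡uA·K : uB ℤ.* X ≡ uA ℤ.* K
      uB·X≡uA·K = begin
        uB ℤ.* X
          ≡⟨ ZS.solve 5 (λ uB d q' wA pJ → uB ZS.:* (d ZS.:* q' ZS.:+ wA ZS.:* pJ) ZS.:= d ZS.:* (q' ZS.:* uB) ZS.:+ (wA ZS.:* uB) ZS.:* pJ)
               refl uB δ q' wA (p^ℤ J) ⟩
        δ ℤ.* (q' ℤ.* uB) ℤ.+ (wA ℤ.* uB) ℤ.* p^ℤ J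
          ≡⟨ cong₂ (λ x y → δ ℤ.* x ℤ.+ y ℤ.* p^ℤ J) (sym q≡q'uB) wA·uB≡ ⟩
        δ ℤ.* q ℤ.+ (uA ℤ.* wB ℤ.- δ ℤ.* p^ℤ E) ℤ.* p^ℤ J
          ≡⟨ ZS.solve 6 (λ d q uA wB pE pJ → d ZS.:* q ZS.:+ (uA ZS.:* wB ZS.:- d ZS.:* pE) ZS.:* pJ
                                         ZS.:= d ZS.:* (q ZS.:- pE ZS.:* pJ) ZS.:+ uA ZS.:* wB ZS.:* pJ)
               refl δ q uA wB (p^ℤ E) (p^ℤ J) ⟩
        δ ℤ.* (q ℤ.- p^ℤ E ℤ.* p^ℤ J) ℤ.+ uA ℤ.* wB ℤ.* p^ℤ J
          ≡⟨ cong (λ z → δ ℤ.* (q ℤ.- z) ℤ.+ uA ℤ.* wB ℤ.* p^ℤ J) (trans (sym (ℤP.^-distribˡ-+-* (+ p) E J)) (cong p^ℤ_ E+J≡j)) ⟩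
        δ ℤ.* (q ℤ.- p^ℤ j) ℤ.+ uA ℤ.* wB ℤ.* p^ℤ J
          ≡⟨ cong (λ z → δ ℤ.* z ℤ.+ uA ℤ.* wB ℤ.* p^ℤ J) q-p^j≡ ⟩
        δ ℤ.* (ℓ ℤ.* (uA ℤ.* uA)) ℤ.+ uA ℤ.* wB ℤ.* p^ℤ J
          ≡⟨ ZS.solve 5 (λ d l uA wB pJ → d ZS.:* (l ZS.:* (uA ZS.:* uA)) ZS.:+ uA ZS.:* wB ZS.:* pJ
                                      ZS.:= uA ZS.:* (d ZS.:* l ZS.:* uA ZS.:+ wB ZS.:* pJ))
               refl δ ℓ uA wB (p^ℤ J) ⟩
        uA ℤ.* K ∎
        where
        open ≡-Reasoning
        wA·uB≡ : wA ℤ.* uB ≡ uA ℤ.* wB ℤ.- δ ℤ.* p^ℤ E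
        wA·uB≡ = trans (ZS.solve 3 (λ a b c → a ZS.:= b ZS.:- (b ZS.:- a)) refl (wA ℤ.* uB) (uA ℤ.* wB) (δ ℤ.* p^ℤ E))
                       (cong (λ z → uA ℤ.* wB ℤ.- z) det-integral)

      -- Since δ² = 1, δ·(uA wB − wA uB) = p^E; multiply by X and use uB X = uA K.
      uA∣p^E·X : uA ℤS.∣ p^ℤ E ℤ.* X
      uA∣p^E·X = ℤS.divides (δ ℤ.* (wB ℤ.* X ℤ.- wA ℤ.* K)) (begin
        p^ℤ E ℤ.* X                                       ≡⟨ sym (ℤP.*-identityˡ _) ⟩
        + 1 ℤ.* (p^ℤ E ℤ.* X)                             ≡⟨ cong (ℤ._* (p^ℤ E ℤ.* X)) (sym δ²≡1) ⟩
        δ ℤ.* δ ℤ.* (p^ℤ E ℤ.* X)                         ≡⟨ ZS.solve 3 (λ d a b → d ZS.:* d ZS.:* (a ZS.:* b) ZS.:= d ZS.:* ((d ZS.:* a) ZS.:* b)) refl δ (p^ℤ E) X ⟩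
        δ ℤ.* ((δ ℤ.* p^ℤ E) ℤ.* X)                       ≡⟨ cong (λ z → δ ℤ.* (z ℤ.* X)) (sym det-integral) ⟩
        δ ℤ.* ((uA ℤ.* wB ℤ.- wA ℤ.* uB) ℤ.* X)           ≡⟨ ZS.solve 6 (λ d uA wB wA uB X → d ZS.:* ((uA ZS.:* wB ZS.:- wA ZS.:* uB) ZS.:* X)
                                                                                        ZS.:= d ZS.:* (uA ZS.:* wB ZS.:* X ZS.:- wA ZS.:* (uB ZS.:* X))) refl δ uA wB wA uB X ⟩
        δ ℤ.* (uA ℤ.* wB ℤ.* X ℤ.- wA ℤ.* (uB ℤ.* X))     ≡⟨ cong (λ z → δ ℤ.* (uA ℤ.* wB ℤ.* X ℤ.- wA ℤ.* z)) uB·X≡uA·K ⟩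
        δ ℤ.* (uA ℤ.* wB ℤ.* X ℤ.- wA ℤ.* (uA ℤ.* K))     ≡⟨ ZS.solve 6 (λ d uA wB wA K X → d ZS.:* (uA ZS.:* wB ZS.:* X ZS.:- wA ZS.:* (uA ZS.:* K))
                                                                                        ZS.:= d ZS.:* (wB ZS.:* X ZS.:- wA ZS.:* K) ZS.:* uA) refl δ uA wB wA K X ⟩
        δ ℤ.* (wB ℤ.* X ℤ.- wA ℤ.* K) ℤ.* uA              ∎)
        where open ≡-Reasoning

      private
        uA∣X : uA ℤS.∣ X
        uA∣X = p∤-∣-p^ℤ* {uA} {X} E p∤uA uA∣p^E·X

      y₀ : ℤ
      y₀ = ℤS._∣_.quotient uA∣X

      X≡y₀uA : X ≡ y₀ ℤ.* uA
      X≡y₀uA = ℤS._∣_.equality uA∣X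

      uB·y₀≡K : uB ℤ.* y₀ ≡ K
      uB·y₀≡K = ℤP.*-cancelʳ-≡ (uB ℤ.* y₀) K uA {{ℤ.≢-nonZero (p∤⇒≢0 {uA} p∤uA)}} (begin
        uB ℤ.* y₀ ℤ.* uA     ≡⟨ ℤP.*-assoc uB y₀ uA ⟩
        uB ℤ.* (y₀ ℤ.* uA)   ≡⟨ cong (uB ℤ.*_) (sym X≡y₀uA) ⟩
        uB ℤ.* X             ≡⟨ uB·X≡uA·K ⟩
        uA ℤ.* K             ≡⟨ ℤP.*-comm uA K ⟩
        K ℤ.* uA             ∎)
        where open ≡-Reasoning

      -- X = δ q' + wA p^J with J ≥ 1, and p ∤ δ q'.
      p∤X : p∤ X
      p∤X = subst p∤_ (cong (λ z → δ ℤ.* q' ℤ.+ z) wA·p^J≡)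
              (p∤-+p* {δ ℤ.* q'} (wA ℤ.* p^ℤ (J ℕ.∸ 1)) (p∤-* {δ} {q'} p∤δ p∤q'))
        where
        wA·p^J≡ : wA ℤ.* p^ℤ (J ℕ.∸ 1) ℤ.* + p ≡ wA ℤ.* p^ℤ J
        wA·p^J≡ = trans (ZS.solve 3 (λ a b c → a ZS.:* b ZS.:* c ZS.:= a ZS.:* (c ZS.:* b)) refl wA (p^ℤ (J ℕ.∸ 1)) (+ p))
                        (cong (λ i → wA ℤ.* p^ℤ i) (trans (ℕP.+-comm 1 (J ℕ.∸ 1)) (ℕP.m∸n+n≡m 1≤J)))

      p∤y₀ : p∤ y₀
      p∤y₀ p∣y₀ = p∤X (subst (+ p ℤD.∣_) (trans (ℤP.*-comm uA y₀) (sym X≡y₀uA)) (p∣-* uA p∣y₀))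

      c x : ℚ
      c = ι (ℤ.- y₀) ℚ.* ℚ.1/_ (p^ J) {{ℚ.≢-nonZero (p^≢0 J)}}
      x = ι (+ 2) ℚ.* c

      c·p^J≡ : c ℚ.* p^ J ≡ ι (ℤ.- y₀)
      c·p^J≡ = trans (ℚP.*-assoc (ι (ℤ.- y₀)) _ (p^ J))
        (trans (cong (ι (ℤ.- y₀) ℚ.*_) (ℚP.*-inverseˡ (p^ J) {{ℚ.≢-nonZero (p^≢0 J)}})) (ℚP.*-identityʳ _))

      c-den : Den≡ J c
      c-den = den≡ (ℤ.- y₀) (p∤-neg {y₀} p∤y₀) c·p^J≡

      x-den : Den≡ J x
      x-den = Den≡-2* c-den

      A-part : ℤ.- y₀ ℤ.* uA ℤ.+ wA ℤ.* p^ℤ J ≡ ℤ.- (δ ℤ.* q')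
      A-part = begin
        ℤ.- y₀ ℤ.* uA ℤ.+ wA ℤ.* p^ℤ J     ≡⟨ cong (ℤ._+ wA ℤ.* p^ℤ J) (sym (ℤP.neg-distribˡ-* y₀ uA)) ⟩
        ℤ.- (y₀ ℤ.* uA) ℤ.+ wA ℤ.* p^ℤ J   ≡⟨ cong (λ z → ℤ.- z ℤ.+ wA ℤ.* p^ℤ J) (sym X≡y₀uA) ⟩
        ℤ.- X ℤ.+ wA ℤ.* p^ℤ J             ≡⟨ ZS.solve 3 (λ a b w → ZS.:- (a ZS.:+ w) ZS.:+ w ZS.:= ZS.:- a) refl (δ ℤ.* q') wA (wA ℤ.* p^ℤ J) ⟩
        ℤ.- (δ ℤ.* q')                     ∎
        where open ≡-Reasoning

      B-part : ℤ.- y₀ ℤ.* uB ℤ.+ wB ℤ.* p^ℤ J ≡ ℤ.- (δ ℤ.* ℓ ℤ.* uA)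
      B-part = begin
        ℤ.- y₀ ℤ.* uB ℤ.+ wB ℤ.* p^ℤ J     ≡⟨ cong (ℤ._+ wB ℤ.* p^ℤ J) (trans (sym (ℤP.neg-distribˡ-* y₀ uB)) (cong ℤ.-_ (ℤP.*-comm y₀ uB))) ⟩
        ℤ.- (uB ℤ.* y₀) ℤ.+ wB ℤ.* p^ℤ J   ≡⟨ cong (λ z → ℤ.- z ℤ.+ wB ℤ.* p^ℤ J) uB·y₀≡K ⟩
        ℤ.- K ℤ.+ wB ℤ.* p^ℤ J             ≡⟨ ZS.solve 2 (λ a w → ZS.:- (a ZS.:+ w) ZS.:+ w ZS.:= ZS.:- a) refl (δ ℤ.* ℓ ℤ.* uA) (wB ℤ.* p^ℤ J) ⟩
        ℤ.- (δ ℤ.* ℓ ℤ.* uA)               ∎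
        where open ≡-Reasoning

      key-identity : m ℤ.* (uA ℤ.* (ℤ.- y₀ ℤ.* uA ℤ.+ wA ℤ.* p^ℤ J)) ≡ uB ℤ.* (ℤ.- y₀ ℤ.* uB ℤ.+ wB ℤ.* p^ℤ J)
      key-identity = begin
        m ℤ.* (uA ℤ.* (ℤ.- y₀ ℤ.* uA ℤ.+ wA ℤ.* p^ℤ J))   ≡⟨ cong (λ z → m ℤ.* (uA ℤ.* z)) A-part ⟩
        r ℤ.* ℓ ℤ.* (uA ℤ.* ℤ.- (δ ℤ.* q'))              ≡⟨ ZS.solve 5 (λ r l uA d q' → r ZS.:* l ZS.:* (uA ZS.:* ZS.:- (d ZS.:* q'))
                                                                               ZS.:= (r ZS.:* q') ZS.:* ZS.:- (d ZS.:* l ZS.:* uA)) refl r ℓ uA δ q' ⟩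
        (r ℤ.* q') ℤ.* ℤ.- (δ ℤ.* ℓ ℤ.* uA)              ≡⟨ cong (ℤ._* ℤ.- (δ ℤ.* ℓ ℤ.* uA)) rq'≡uB ⟩
        uB ℤ.* ℤ.- (δ ℤ.* ℓ ℤ.* uA)                      ≡⟨ cong (uB ℤ.*_) (sym B-part) ⟩
        uB ℤ.* (ℤ.- y₀ ℤ.* uB ℤ.+ wB ℤ.* p^ℤ J)          ∎
        where open ≡-Reasoning

      scaled-form : ∀ {e y y' w w'} → y ℚ.* p^ e ≡ ι w → y' ℚ.* p^ e ≡ ι w' →
        y ℚ.* (c ℚ.* y ℚ.+ y') ℚ.* (p^ e ℚ.* p^ e ℚ.* p^ J) ≡ ι (w ℤ.* (ℤ.- y₀ ℤ.* w ℤ.+ w' ℤ.* p^ℤ J))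
      scaled-form {e} {y} {y'} {w} {w'} hy hy' = begin
        y ℚ.* (c ℚ.* y ℚ.+ y') ℚ.* (p^ e ℚ.* p^ e ℚ.* p^ J)
          ≡⟨ solve 5 (λ y c y' P Q → y :* (c :* y :+ y') :* (P :* P :* Q) := (y :* P) :* ((c :* Q) :* (y :* P) :+ (y' :* P) :* Q))
               refl y c y' (p^ e) (p^ J) ⟩
        (y ℚ.* p^ e) ℚ.* ((c ℚ.* p^ J) ℚ.* (y ℚ.* p^ e) ℚ.+ (y' ℚ.* p^ e) ℚ.* p^ J)
          ≡⟨ cong (λ z → z ℚ.* ((c ℚ.* p^ J) ℚ.* z ℚ.+ (y' ℚ.* p^ e) ℚ.* p^ J)) hy ⟩
        ι w ℚ.* ((c ℚ.* p^ J) ℚ.* ι w ℚ.+ (y' ℚ.* p^ e) ℚ.* p^ J)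
          ≡⟨ cong₂ (λ z z' → ι w ℚ.* (z ℚ.* ι w ℚ.+ z' ℚ.* p^ J)) c·p^J≡ hy' ⟩
        ι w ℚ.* (ι (ℤ.- y₀) ℚ.* ι w ℚ.+ ι w' ℚ.* p^ J)
          ≡⟨ cong (λ z → ι w ℚ.* (ι (ℤ.- y₀) ℚ.* ι w ℚ.+ ι w' ℚ.* z)) (p^≡ι J) ⟩
        ι w ℚ.* (ι (ℤ.- y₀) ℚ.* ι w ℚ.+ ι w' ℚ.* ι (p^ℤ J))
          ≡⟨ sym (trans (ι-homo-* w _) (cong (ι w ℚ.*_) (ι-homo-*+* (ℤ.- y₀) w w' (p^ℤ J)))) ⟩
        ι (w ℤ.* (ℤ.- y₀ ℤ.* w ℤ.+ w' ℤ.* p^ℤ J)) ∎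
        where open ≡-Reasoning

      D : ℚ
      D = ι (p^ℤ (2 ℕ.* k₀) ℤ.* m)

      -- Clearing denominators turns this into key-identity.
      balanced : D ℚ.* (A ℚ.* (c ℚ.* A ℚ.+ A')) ≡ B ℚ.* (c ℚ.* B ℚ.+ B')
      balanced = *-cancelʳ-≢0 Z≢0 (begin
        D ℚ.* (A ℚ.* (c ℚ.* A ℚ.+ A')) ℚ.* Z
          ≡⟨ ℚP.*-assoc D _ Z ⟩
        D ℚ.* (A ℚ.* (c ℚ.* A ℚ.+ A') ℚ.* Z)
          ≡⟨ cong (D ℚ.*_) (scaled-form {eA} {A} {A'} {uA} {wA} A≡ A'≡) ⟩
        D ℚ.* ι (uA ℤ.* LA)
          ≡⟨ sym (ι-homo-* (p^ℤ (2 ℕ.* k₀) ℤ.* m) (uA ℤ.* LA)) ⟩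
        ι (p^ℤ (2 ℕ.* k₀) ℤ.* m ℤ.* (uA ℤ.* LA))
          ≡⟨ cong ι integral ⟩
        ι (uB ℤ.* LB ℤ.* (p^ℤ k₀ ℤ.* p^ℤ k₀))
          ≡⟨ ι-homo-* (uB ℤ.* LB) (p^ℤ k₀ ℤ.* p^ℤ k₀) ⟩
        ι (uB ℤ.* LB) ℚ.* ι (p^ℤ k₀ ℤ.* p^ℤ k₀)
          ≡⟨ cong₂ ℚ._*_ (sym (scaled-form {eB} {B} {B'} {uB} {wB} B≡ B'≡)) (trans (ι-homo-* (p^ℤ k₀) (p^ℤ k₀)) (sym (cong₂ ℚ._*_ (p^≡ι k₀) (p^≡ι k₀)))) ⟩
        B ℚ.* (c ℚ.* B ℚ.+ B') ℚ.* (p^ eB ℚ.* p^ eB ℚ.* p^ J) ℚ.* (p^ k₀ ℚ.* p^ k₀)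
          ≡⟨ ℚP.*-assoc (B ℚ.* (c ℚ.* B ℚ.+ B')) _ _ ⟩
        B ℚ.* (c ℚ.* B ℚ.+ B') ℚ.* (p^ eB ℚ.* p^ eB ℚ.* p^ J ℚ.* (p^ k₀ ℚ.* p^ k₀))
          ≡⟨ cong (B ℚ.* (c ℚ.* B ℚ.+ B') ℚ.*_) (sym Z≡) ⟩
        B ℚ.* (c ℚ.* B ℚ.+ B') ℚ.* Z ∎)
        where
        open ≡-Reasoning
        LA LB : ℤ
        LA = ℤ.- y₀ ℤ.* uA ℤ.+ wA ℤ.* p^ℤ J
        LB = ℤ.- y₀ ℤ.* uB ℤ.+ wB ℤ.* p^ℤ J
        Z : ℚ
        Z = p^ eA ℚ.* p^ eA ℚ.* p^ J
        Z≢0 : Z ≢ 0ℚ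
        Z≢0 = *-≢0 (*-≢0 (p^≢0 eA) (p^≢0 eA)) (p^≢0 J)
        Z≡ : Z ≡ p^ eB ℚ.* p^ eB ℚ.* p^ J ℚ.* (p^ k₀ ℚ.* p^ k₀)
        Z≡ = trans (cong (λ z → z ℚ.* z ℚ.* p^ J) (trans (cong p^_ eA≡k₀+eB) (p^-+ k₀ eB)))
                   (solve 3 (λ k e j → k :* e :* (k :* e) :* j := e :* e :* j :* (k :* k)) refl (p^ k₀) (p^ eB) (p^ J))
        integral : p^ℤ (2 ℕ.* k₀) ℤ.* m ℤ.* (uA ℤ.* LA) ≡ uB ℤ.* LB ℤ.* (p^ℤ k₀ ℤ.* p^ℤ k₀)
        integral = begin
          p^ℤ (2 ℕ.* k₀) ℤ.* m ℤ.* (uA ℤ.* LA)        ≡⟨ cong (λ z → z ℤ.* m ℤ.* (uA ℤ.* LA)) p^2k₀≡ ⟩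
          p^ℤ k₀ ℤ.* p^ℤ k₀ ℤ.* m ℤ.* (uA ℤ.* LA)      ≡⟨ ZS.solve 3 (λ P m L → P ZS.:* m ZS.:* L ZS.:= m ZS.:* L ZS.:* P) refl (p^ℤ k₀ ℤ.* p^ℤ k₀) m (uA ℤ.* LA) ⟩
          m ℤ.* (uA ℤ.* LA) ℤ.* (p^ℤ k₀ ℤ.* p^ℤ k₀)    ≡⟨ cong (ℤ._* (p^ℤ k₀ ℤ.* p^ℤ k₀)) key-identity ⟩
          uB ℤ.* LB ℤ.* (p^ℤ k₀ ℤ.* p^ℤ k₀)           ∎
          where
          p^2k₀≡ : p^ℤ (2 ℕ.* k₀) ≡ p^ℤ k₀ ℤ.* p^ℤ k₀
          p^2k₀≡ = trans (cong p^ℤ_ (cong (k₀ ℕ.+_) (ℕP.+-identityʳ k₀))) (ℤP.^-distribˡ-+-* (+ p) k₀ k₀)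

      module Continued = PeriodicConvergence a x u a-large (J , 1≤J , x-den) 1≤k₀ a₀-den

      Dβ≡γ : D ℚ.* Continued.β ≡ Continued.γ
      Dβ≡γ = begin
        D ℚ.* Continued.β
          ≡⟨ cong (D ℚ.*_) Continued.β≡ ⟩
        D ℚ.* (x ℚ.* A ℚ.* A ℚ.+ (1ℚ ℚ.+ 1ℚ) ℚ.* A ℚ.* A')
          ≡⟨ cong (λ z → D ℚ.* (z ℚ.* c ℚ.* A ℚ.* A ℚ.+ (1ℚ ℚ.+ 1ℚ) ℚ.* A ℚ.* A')) ι2≡1+1 ⟩
        D ℚ.* ((1ℚ ℚ.+ 1ℚ) ℚ.* c ℚ.* A ℚ.* A ℚ.+ (1ℚ ℚ.+ 1ℚ) ℚ.* A ℚ.* A')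
          ≡⟨ solve 4 (λ D c A A' → D :* ((con 1ℚ :+ con 1ℚ) :* c :* A :* A :+ (con 1ℚ :+ con 1ℚ) :* A :* A')
                                := (con 1ℚ :+ con 1ℚ) :* (D :* (A :* (c :* A :+ A')))) refl D c A A' ⟩
        (1ℚ ℚ.+ 1ℚ) ℚ.* (D ℚ.* (A ℚ.* (c ℚ.* A ℚ.+ A')))
          ≡⟨ cong ((1ℚ ℚ.+ 1ℚ) ℚ.*_) balanced ⟩
        (1ℚ ℚ.+ 1ℚ) ℚ.* (B ℚ.* (c ℚ.* B ℚ.+ B'))
          ≡⟨ solve 3 (λ c B B' → (con 1ℚ :+ con 1ℚ) :* (B :* (c :* B :+ B'))
                              := (con 1ℚ :+ con 1ℚ) :* c :* B :* B :+ (con 1ℚ :+ con 1ℚ) :* B :* B') refl c B B' ⟩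
        (1ℚ ℚ.+ 1ℚ) ℚ.* c ℚ.* B ℚ.* B ℚ.+ (1ℚ ℚ.+ 1ℚ) ℚ.* B ℚ.* B'
          ≡⟨ cong (λ z → z ℚ.* c ℚ.* B ℚ.* B ℚ.+ (1ℚ ℚ.+ 1ℚ) ℚ.* B ℚ.* B') (sym ι2≡1+1) ⟩
        x ℚ.* B ℚ.* B ℚ.+ (1ℚ ℚ.+ 1ℚ) ℚ.* B ℚ.* B'
          ≡⟨ sym Continued.γ≡ ⟩
        Continued.γ ∎
        where open ≡-Reasoning

      converges : ConvergesToInvPowSqrt p (periodicSeq (suc u) a x) k₀ m
      converges = Continued.converges k₀ m Dβ≡γ

      -- A square root z of m would give (z uA)² = r (q − p^j) = uB² − r p^j.
      m-nonsquare : ℤ.∣ r ∣ ℕ.+ 2 ℕ.* ℤ.∣ uB ∣ < p ℕ.^ J → NonSquare p m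
      m-nonsquare bound (z , z²≡m) = not-square {uB} {r} {j} (z ℤ.* uA) p∤uB r≢0
        (ℕP.<-≤-trans bound (ℕP.^-monoʳ-≤ p (subst (J ≤_) E+J≡j (ℕP.m≤n+m J E)))) (begin
        z ℤ.* uA ℤ.* (z ℤ.* uA)       ≡⟨ ZS.solve 2 (λ z u → z ZS.:* u ZS.:* (z ZS.:* u) ZS.:= (z ZS.:* z) ZS.:* (u ZS.:* u)) refl z uA ⟩
        (z ℤ.* z) ℤ.* (uA ℤ.* uA)     ≡⟨ cong (ℤ._* (uA ℤ.* uA)) z²≡m ⟩
        r ℤ.* ℓ ℤ.* (uA ℤ.* uA)       ≡⟨ ℤP.*-assoc r ℓ (uA ℤ.* uA) ⟩
        r ℤ.* (ℓ ℤ.* (uA ℤ.* uA))     ≡⟨ cong (r ℤ.*_) (sym q-p^j≡) ⟩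
        r ℤ.* (q ℤ.- p^ℤ j)           ≡⟨ ZS.solve 3 (λ r q w → r ZS.:* (q ZS.:- w) ZS.:= r ZS.:* q ZS.:- r ZS.:* w) refl r q (p^ℤ j) ⟩
        r ℤ.* q ℤ.- r ℤ.* p^ℤ j       ≡⟨ cong (ℤ._- r ℤ.* p^ℤ j) (sym uB²≡rq) ⟩
        uB ℤ.* uB ℤ.- r ℤ.* p^ℤ j     ∎)
        where open ≡-Reasoning

      -- |y₀ uA| = |X| ≤ |q'| + |wA| p^J, and niceness (b) gives 4|wA| < p|uA|.
      4y₀<p·p^J : 4 ℕ.* ℤ.∣ q' ∣ < p ℕ.^ J → 4 ℕ.* ℤ.∣ y₀ ∣ < p ℕ.* p ℕ.^ J
      4y₀<p·p^J 4q'<p^J = ℕP.*-cancelʳ-< ℤ.∣ uA ∣ (4 ℕ.* ℤ.∣ y₀ ∣) (p ℕ.* p ℕ.^ J) (begin-strict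
        4 ℕ.* ℤ.∣ y₀ ∣ ℕ.* ℤ.∣ uA ∣                 ≡⟨ trans (ℕP.*-assoc 4 ℤ.∣ y₀ ∣ ℤ.∣ uA ∣) (cong (4 ℕ.*_) (sym ∣X∣≡)) ⟩
        4 ℕ.* ℤ.∣ X ∣                               ≤⟨ ℕP.*-monoʳ-≤ 4 ∣X∣≤ ⟩
        4 ℕ.* (ℤ.∣ q' ∣ ℕ.+ ℤ.∣ wA ∣ ℕ.* P)         ≡⟨ NS.solve 3 (λ q w x → NS.con 4 NS.:* (q NS.:+ w NS.:* x)
                                                                    NS.:= NS.con 4 NS.:* q NS.:+ (NS.con 4 NS.:* w) NS.:* x) refl ℤ.∣ q' ∣ ℤ.∣ wA ∣ P ⟩
        4 ℕ.* ℤ.∣ q' ∣ ℕ.+ (4 ℕ.* ℤ.∣ wA ∣) ℕ.* P   <⟨ ℕP.+-monoˡ-< _ 4q'<p^J ⟩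
        suc (4 ℕ.* ℤ.∣ wA ∣) ℕ.* P                  ≤⟨ ℕP.*-monoˡ-≤ P 4wA<p·uA ⟩
        p ℕ.* ℤ.∣ uA ∣ ℕ.* P                        ≡⟨ NS.solve 3 (λ p a x → p NS.:* a NS.:* x NS.:= p NS.:* x NS.:* a) refl p ℤ.∣ uA ∣ P ⟩
        p ℕ.* P ℕ.* ℤ.∣ uA ∣                        ∎)
        where
        open ℕP.≤-Reasoning
        P : ℕ
        P = p ℕ.^ J
        ∣X∣≡ : ℤ.∣ X ∣ ≡ ℤ.∣ y₀ ∣ ℕ.* ℤ.∣ uA ∣
        ∣X∣≡ = trans (cong ℤ.∣_∣ X≡y₀uA) (ℤP.abs-* y₀ uA)
        ∣X∣≤ : ℤ.∣ X ∣ ≤ ℤ.∣ q' ∣ ℕ.+ ℤ.∣ wA ∣ ℕ.* P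
        ∣X∣≤ = ℕP.≤-trans (ℤP.∣i+j∣≤∣i∣+∣j∣ (δ ℤ.* q') (wA ℤ.* p^ℤ J))
          (ℕP.≤-reflexive (cong₂ ℕ._+_ (trans (ℤP.abs-* δ q') (trans (cong (ℕ._* ℤ.∣ q' ∣) ∣δ∣≡1) (ℕP.*-identityˡ _)))
                                       (trans (ℤP.abs-* wA (p^ℤ J)) (cong (ℤ.∣ wA ∣ ℕ.*_) (∣p^ℤ∣ J)))))

      c∈Y : 4 ℕ.* ℤ.∣ q' ∣ < p ℕ.^ J → InY p c
      c∈Y 4q'<p^J = (J , ℤ.- y₀ , c·p^J≡) , within-p {ι (+ 2) ℚ.* c} {+ 2 ℤ.* ℤ.- y₀} J (Den≡.unit-eq x-den)
        (ℕP.≤-<-trans (ℕP.≤-reflexive ∣2y₀∣≡) (ℕP.≤-<-trans (ℕP.*-monoˡ-≤ ℤ.∣ y₀ ∣ {2} {4} (ℕ.s≤s (ℕ.s≤s ℕ.z≤n))) (4y₀<p·p^J 4q'<p^J)))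
        where
        ∣2y₀∣≡ : ℤ.∣ + 2 ℤ.* ℤ.- y₀ ∣ ≡ 2 ℕ.* ℤ.∣ y₀ ∣
        ∣2y₀∣≡ = trans (ℤP.abs-* (+ 2) (ℤ.- y₀)) (cong (2 ℕ.*_) (ℤP.∣-i∣≡∣i∣ y₀))

      x∈Y : 4 ℕ.* ℤ.∣ q' ∣ < p ℕ.^ J → InY p x
      x∈Y 4q'<p^J = (J , + 2 ℤ.* ℤ.- y₀ , Den≡.unit-eq x-den) , within-p {ι (+ 2) ℚ.* x} {+ 2 ℤ.* (+ 2 ℤ.* ℤ.- y₀)} J
        (Den≡.unit-eq (Den≡-2* x-den)) (ℕP.≤-<-trans (ℕP.≤-reflexive ∣4y₀∣≡) (4y₀<p·p^J 4q'<p^J))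
        where
        ∣4y₀∣≡ : ℤ.∣ + 2 ℤ.* (+ 2 ℤ.* ℤ.- y₀) ∣ ≡ 4 ℕ.* ℤ.∣ y₀ ∣
        ∣4y₀∣≡ = trans (ℤP.abs-* (+ 2) (+ 2 ℤ.* ℤ.- y₀))
          (trans (cong (2 ℕ.*_) (trans (ℤP.abs-* (+ 2) (ℤ.- y₀)) (cong (2 ℕ.*_) (ℤP.∣-i∣≡∣i∣ y₀))))
                 (sym (ℕP.*-assoc 2 2 ℤ.∣ y₀ ∣)))

      x∉ : (L : List ℚ) → denominatorSum L < p ℕ.^ J → x ∉ L
      x∉ L = ∉-large-denominator {x} {+ 2 ℤ.* ℤ.- y₀} {J} L (Den≡.p∤unit x-den) (Den≡.unit-eq x-den)

    -- Taking J large enough makes all three smallness conditions hold at once.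
    good-2c : (L : List ℚ) → ∃ λ (cₜ : ℚ) →
              InY p cₜ × InY p (ι (+ 2) ℚ.* cₜ) × (ι (+ 2) ℚ.* cₜ) ∉ L × Good p (suc u) a k₀ (ι (+ 2) ℚ.* cₜ)
    good-2c L = c , c∈Y small₁ , x∈Y small₁ , x∉ L small₃ , (m , m-nonsquare small₂ , converges)
      where
      S : ℕ
      S = 4 ℕ.* ℤ.∣ q' ∣ ℕ.+ (ℤ.∣ r ∣ ℕ.+ 2 ℕ.* ℤ.∣ uB ∣) ℕ.+ denominatorSum L
      open Choice (suc S) (ℕ.s≤s ℕ.z≤n)
      S<p^J : S < p ℕ.^ J
      S<p^J = ℕP.<-≤-trans Lb≤J (ℕP.<⇒≤ (n<p^n J))
      small₁ : 4 ℕ.* ℤ.∣ q' ∣ < p ℕ.^ J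
      small₁ = ℕP.≤-<-trans (ℕP.≤-trans (ℕP.m≤m+n _ _) (ℕP.m≤m+n _ (denominatorSum L))) S<p^J
      small₂ : ℤ.∣ r ∣ ℕ.+ 2 ℕ.* ℤ.∣ uB ∣ < p ℕ.^ J
      small₂ = ℕP.≤-<-trans (ℕP.≤-trans (ℕP.m≤n+m _ (4 ℕ.* ℤ.∣ q' ∣)) (ℕP.m≤m+n _ (denominatorSum L))) S<p^J
      small₃ : denominatorSum L < p ℕ.^ J
      small₃ = ℕP.≤-<-trans (ℕP.m≤n+m (denominatorSum L) _) S<p^J

theorem5p6 : (p : ℕ) → Prime p → 2 < p →
    (t : ℕ) → 1 ≤ t → (a : ℕ → ℚ) →
    IsFiniteBCF p t a → IsNice p t a →
    (k₀ : ℕ) → Vp p (a 0) (ℤ.- (+ k₀)) →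
    ((L : List ℚ) → ∃ λ (aₜ : ℚ) →
        InY p aₜ × aₜ ∉ L × Good p t a k₀ aₜ) ×
    ((L : List ℚ) → ∃ λ (cₜ : ℚ) →
        InY p cₜ × InY p (ι (+ 2) ℚ.* cₜ) × (ι (+ 2) ℚ.* cₜ) ∉ L ×
        Good p t a k₀ (ι (+ 2) ℚ.* cₜ))
theorem5p6 p p-prime 2<p zero    () a bcf nice k₀ v-a₀
-- The bound |a₀| < p/4 of niceness (a) only keeps 2a₀ in 𝒴; convergence does not need it.
theorem5p6 p p-prime 2<p (suc u) _  a bcf
  ((a₀-large , _) , (_ , nice-b) , (Ã , B̃ , Ã-tilde , B̃-tilde , q , B̃∣q , q∣B̃² , j₀ , Ã²∣q-p^j₀)) k₀ v-a₀ =
  aₜ-family , good-2c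
  where
  open Construction p p-prime 2<p u a bcf a₀-large nice-b {Ã} {B̃} {q} {j₀} Ã-tilde B̃-tilde B̃∣q q∣B̃² Ã²∣q-p^j₀ k₀ v-a₀
  aₜ-family : (L : List ℚ) → ∃ λ aₜ → InY p aₜ × aₜ ∉ L × Good p (suc u) a k₀ aₜ
  aₜ-family L = let c , _ , 2c∈Y , 2c∉L , good = good-2c L in ι (+ 2) ℚ.* c , 2c∈Y , 2c∉L , good
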